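{- The QBF proof system LQU$^+$-Res has feasible interpolation. That is, there is an effective procedure which, given any LQU$^+$-Res refutation $\pi$ of a false QBF $\mathcal{F}=\exists \vec{p}\, \mathcal{Q}\vec{q}\, \mathcal{Q}\vec{r}.\,[A(\vec{p},\vec{q})\wedge B(\vec{p},\vec{r})]$ (with $\vec p,\vec q,\vec r$ mutually disjoint sets of variables, $A$ a CNF over $\vec p,\vec q$, $B$ a CNF over $\vec p,\vec r$, and the $\vec q$ and $\vec r$ variables quantified arbitrarily with any number of alternations), outputs a Boolean circuit $G$ with inputs $\vec p$, of size polynomial in the size of $\pi$, such that for every $0/1$ assignment $\vec a$ to $\vec p$: if $G(\vec a)=0$ then $\mathcal{Q}\vec q.\,A(\vec a,\vec q)$ is false, and if $G(\vec a)=1$ then $\mathcal{Q}\vec r.\,B(\vec a,\vec r)$ is false.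
   Context: QBFs are closed, in prenex form $Q_1x_1\dots Q_nx_n.\phi$ with $Q_i\in\{\exists,\forall\}$ and $\phi$ a CNF in which no clause contains complementary literals. The index $\mathrm{ind}(x_i)=i$; a literal is existential/universal according to its variable, and $\mathrm{ind}(l)=\mathrm{ind}(\mathrm{var}(l))$. $A(\vec a,\vec q)$ denotes $A$ restricted by the assignment $\vec a$. In LQU$^+$-Res, lines are clauses which may also contain special "merged" literals $u^*$ for universal variables $u$, with $\mathrm{ind}(u^*)=\mathrm{ind}(u)$. Rules: (Axiom) any clause of the matrix. ($\forall$-Red) from $D\vee u$ (or $D\vee u^*$), where $u$ is a universal literal, derive $D$, provided $\mathrm{ind}(u)\ge \mathrm{ind}(l)$ for every existential literal $l\in D$. (Res) from $C_1\vee U_1\vee x$ and $C_2\vee U_2\vee\neg x$ derive $C_1\vee C_2\vee U$, where the pivot $x$ is an existential or universal variable (never a merged literal), and: if $l_1\in C_1$, $l_2\in C_2$ with $\mathrm{var}(l_1)=\mathrm{var}(l_2)=z$ then $l_1=l_2\ne z^*$; $U_1,U_2$ contain only universal literals with $\mathrm{var}(U_1)=\mathrm{var}(U_2)$; $\mathrm{ind}(x)<\mathrm{ind}(u)$ for each $u\in\mathrm{var}(U_1)$; if $w_1\in U_1$, $w_2\in U_2$ with $\mathrm{var}(w_1)=\mathrm{var}(w_2)=u$ then $w_1=\neg w_2$ or $w_1=u^*$ or $w_2=u^*$; and $U=\{u^*: u\in\mathrm{var}(U_1)\}$. A refutation is a derivation of the empty clause; its size is its number of clauses. -}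

module Defs where

open import Data.Nat using (ℕ; zero; suc; _+_; _*_; _^_; _≤_; _<_)
open import Data.Fin using (Fin; zero; suc; toℕ; _↑ˡ_; _↑ʳ_)
open import Data.Vec using (Vec; []; _∷_; lookup; replicate; head) renaming (_++_ to _++ⱽ_)
open import Data.List using (List; []; _∷_; map; length; _++_)
open import Data.List.Membership.Propositional using (_∈_)
open import Data.Bool using (Bool; true; false; _∧_; _∨_; not)
open import Data.Sum using (_⊎_; inj₁; inj₂)
open import Data.Product using (Σ; _×_; _,_)
open import Data.Empty using (⊥)
open import Data.Unit using (⊤)
open import Function using (_∘_)
open import Relation.Binary.PropositionalEquality using (_≡_)
open import Relation.Nullary using (¬_)

data Quant : Set where
  ∃Q ∀Q : Quant

data Lit (V : Set) : Set where
  pos neg : V → Lit V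

var : {V : Set} → Lit V → V
var (pos x) = x
var (neg x) = x

compl : {V : Set} → Lit V → Lit V
compl (pos x) = neg x
compl (neg x) = pos x

mapLit : {V W : Set} → (V → W) → Lit V → Lit W
mapLit f (pos x) = pos (f x)
mapLit f (neg x) = neg (f x)

CNF : Set → Set
CNF V = List (List (Lit V))

NonTautCNF : {V : Set} → CNF V → Set
NonTautCNF {V} Φ = ∀ {C} → C ∈ Φ → (x : V) → ¬ ((pos x ∈ C) × (neg x ∈ C))

evalLit : {V : Set} → (V → Bool) → Lit V → Bool
evalLit ρ (pos x) = ρ x
evalLit ρ (neg x) = not (ρ x)

evalClause : {V : Set} → (V → Bool) → List (Lit V) → Bool
evalClause ρ [] = false
evalClause ρ (l ∷ C) = evalLit ρ l ∨ evalClause ρ C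

evalCNF : {V : Set} → (V → Bool) → CNF V → Bool
evalCNF ρ [] = true
evalCNF ρ (C ∷ Φ) = evalClause ρ C ∧ evalCNF ρ Φ

extend : {k : ℕ} → Bool → (Fin k → Bool) → Fin (suc k) → Bool
extend b ρ zero = b
extend b ρ (suc i) = ρ i

combine : Quant → Bool → Bool → Bool
combine ∃Q = _∨_
combine ∀Q = _∧_

-- evalQ (Q₁ ∷ … ∷ Qₖ) f  is the truth value of  Q₁x₁ … Qₖxₖ . f(x₁,…,xₖ)
-- (variable zero is the outermost one)
evalQ : {k : ℕ} → Vec Quant k → ((Fin k → Bool) → Bool) → Bool
evalQ [] f = f (λ ())
evalQ (Q ∷ qs) f =
  combine Q (evalQ qs (λ ρ → f (extend true ρ)))
            (evalQ qs (λ ρ → f (extend false ρ)))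

-- Prenex QBFs: variables are Fin n, ind(x) = toℕ x (0-based; only the
-- order matters), the quantifier of x is lookup prefix x.

record QBF : Set where
  field
    n      : ℕ
    prefix : Vec Quant n
    matrix : CNF (Fin n)

module LQU (F : QBF) where
  open QBF F

  -- lines may contain ordinary literals and merged literals u*
  data PLit : Set where
    lit  : Lit (Fin n) → PLit
    star : Fin n → PLit

  pvar : PLit → Fin n
  pvar (lit l) = var l
  pvar (star u) = u

  Clause : Set
  Clause = List PLit

  IsUniv : Fin n → Set
  IsUniv i = lookup prefix i ≡ ∀Q

  IsExist : Fin n → Set
  IsExist i = lookup prefix i ≡ ∃Q

  ind : Fin n → ℕ
  ind = toℕ

  IsStar : PLit → Set
  IsStar (lit _) = ⊥
  IsStar (star _) = ⊤

  Compl : PLit → PLit → Set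
  Compl w₁ w₂ = Σ (Lit (Fin n)) λ l → (w₁ ≡ lit l) × (w₂ ≡ lit (compl l))

  -- clauses are sets: equality as sets
  _≋_ : Clause → Clause → Set
  C ≋ D = ∀ w → ((w ∈ C → w ∈ D) × (w ∈ D → w ∈ C))

  record ForallRed (E D : Clause) : Set where
    field
      u      : Lit (Fin n)
      univ   : IsUniv (var u)
      w      : PLit
      w-form : (w ≡ lit u) ⊎ (w ≡ star (var u))
      split  : E ≋ (D ++ (w ∷ []))
      order  : ∀ l → lit l ∈ D → IsExist (var l) → ind (var l) ≤ ind (var u)

  record Resolution (E₁ E₂ R : Clause) : Set where
    field
      x       : Fin n
      C₁ U₁ C₂ U₂ : Clause
      split₁  : E₁ ≋ (C₁ ++ U₁ ++ (lit (pos x) ∷ []))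
      split₂  : E₂ ≋ (C₂ ++ U₂ ++ (lit (neg x) ∷ []))
      noClash : ∀ {l₁ l₂} → l₁ ∈ C₁ → l₂ ∈ C₂ → pvar l₁ ≡ pvar l₂ →
                (l₁ ≡ l₂) × ¬ IsStar l₁
      U₁univ  : ∀ {w} → w ∈ U₁ → IsUniv (pvar w)
      U₂univ  : ∀ {w} → w ∈ U₂ → IsUniv (pvar w)
      sameVar : ∀ u → ((u ∈ map pvar U₁ → u ∈ map pvar U₂) ×
                       (u ∈ map pvar U₂ → u ∈ map pvar U₁))
      below   : ∀ {w} → w ∈ U₁ → ind x < ind (pvar w)
      compat  : ∀ {w₁ w₂} → w₁ ∈ U₁ → w₂ ∈ U₂ → pvar w₁ ≡ pvar w₂ →
                Compl w₁ w₂ ⊎ (IsStar w₁ ⊎ IsStar w₂)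
      result  : R ≋ (C₁ ++ C₂ ++ map (star ∘ pvar) U₁)

  data Step (Γ : List Clause) : Clause → Set where
    axiom : ∀ {C} → C ∈ matrix → Step Γ (map lit C)
    red   : ∀ {E D} → E ∈ Γ → ForallRed E D → Step Γ D
    res   : ∀ {E₁ E₂ R} → E₁ ∈ Γ → E₂ ∈ Γ → Resolution E₁ E₂ R → Step Γ R

  data Derivation : List Clause → Set where
    []  : Derivation []
    _▷_ : ∀ {Γ C} → Derivation Γ → Step Γ C → Derivation (Γ ++ (C ∷ []))

  record Refutation : Set where
    field
      lines : List Clause
      deriv : Derivation lines
      empty : [] ∈ lines

  size : Refutation → ℕ
  size π = length (Refutation.lines π)

-- Boolean circuits with m inputs, as straight-line programs.
-- A gate at position k may refer to the k earlier gates; a reference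
-- (i : Fin k) denotes the i-th most recent earlier gate.

data Gate (m k : ℕ) : Set where
  input : Fin m → Gate m k
  const : Bool → Gate m k
  notG  : Fin k → Gate m k
  andG  : Fin k → Fin k → Gate m k
  orG   : Fin k → Fin k → Gate m k

data Gates (m : ℕ) : ℕ → Set where
  []  : Gates m zero
  _▷_ : ∀ {k} → Gates m k → Gate m k → Gates m (suc k)

evalGate : ∀ {m k} → Gate m k → (Fin m → Bool) → Vec Bool k → Bool
evalGate (input i) ρ vs = ρ i
evalGate (const b) ρ vs = b
evalGate (notG i) ρ vs = not (lookup vs i)
evalGate (andG i j) ρ vs = lookup vs i ∧ lookup vs j
evalGate (orG i j) ρ vs = lookup vs i ∨ lookup vs j

-- values of all gates, most recent first
evalGates : ∀ {m k} → Gates m k → (Fin m → Bool) → Vec Bool k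
evalGates [] ρ = []
evalGates (gs ▷ g) ρ = let vs = evalGates gs ρ in evalGate g ρ vs ∷ vs

record Circuit (m : ℕ) : Set where
  field
    k     : ℕ
    gates : Gates m (suc k)

csize : ∀ {m} → Circuit m → ℕ
csize G = suc (Circuit.k G)

output : ∀ {m} → Circuit m → (Fin m → Bool) → Bool
output G ρ = head (evalGates (Circuit.gates G) ρ)

-- The QBF  ∃p⃗ Qq⃗ Qr⃗ . [A(p⃗,q⃗) ∧ B(p⃗,r⃗)]  with |p⃗| = np, |q⃗| = nq, |r⃗| = nr.
-- Variables: p⃗ = 0..np-1, q⃗ = np..np+nq-1, r⃗ = the rest.

embA : ∀ {np nq nr} → Fin np ⊎ Fin nq → Fin (np + (nq + nr))
embA {np} {nq} {nr} (inj₁ i) = i ↑ˡ (nq + nr)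
embA {np} {nq} {nr} (inj₂ j) = np ↑ʳ (j ↑ˡ nr)

embB : ∀ {np nq nr} → Fin np ⊎ Fin nr → Fin (np + (nq + nr))
embB {np} {nq} {nr} (inj₁ i) = i ↑ˡ (nq + nr)
embB {np} {nq} {nr} (inj₂ k) = np ↑ʳ (nq ↑ʳ k)

splitQBF : (np nq nr : ℕ) → Vec Quant nq → Vec Quant nr →
           CNF (Fin np ⊎ Fin nq) → CNF (Fin np ⊎ Fin nr) → QBF
splitQBF np nq nr qs rs A B = record
  { n      = np + (nq + nr)
  ; prefix = replicate np ∃Q ++ⱽ (qs ++ⱽ rs)
  ; matrix = map (map (mapLit (embA {np} {nq} {nr}))) A
          ++ map (map (mapLit (embB {np} {nq} {nr}))) B
  }

module Submission where

-- For every line E of the refutation the circuit computes two bits t and s. If t = 1, E contains a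
-- p-literal made true by a; if t = 0, E keeps a p-literal that is never resolved, or else E restricted
-- by a is subsumed by a derivation in a relaxed LQU⁺-Res from A(a) alone (s = 0) or from B(a) alone
-- (s = 1). On resolution the bits are combined by a multiplexer on a(x) for a p-pivot x, and as
-- (t₁ ∨ t₂, s₁ ∨ s₂) resp. (t₁ ∨ t₂, s₁ ∧ s₂) for a q- resp. r-pivot: a derivation from the other
-- side never mentions x and already subsumes the resolvent. The empty clause forces t = 0, so s names
-- a side with a relaxed refutation of its restricted formula. The relaxed system is sound: restricting
-- a derivation one quantifier level at a time shows, by induction along the prefix, that the formula is
-- false once a clause of universal literals is derived; at a universal level the universal player
-- falsifies the clause on which the last reduction of that level acts.

open import Defs
open import Data.Nat using (ℕ; zero; suc; _+_; _*_; _^_; _∸_; _≤_; _<_; z≤n; s≤s; _≟_; _<?_; _≤?_)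
open import Data.Nat.Tactic.RingSolver using (solve-∀)
open import Data.Nat.Properties
  using (module ≤-Reasoning; ≤-refl; ≤-trans; ≤-reflexive; <-≤-trans; ≤-<-trans; <-irrefl; ≤∧≢⇒<; <⇒≤; ≤-pred; ≮⇒≥;
         m≤n⇒m≤1+n; m<n⇒m<1+n; m≤m+n; m≤n+m; n≤1+n; m<n+m; ≤-antisym; +-suc; +-comm; +-assoc;
         +-identityʳ; +-monoˡ-≤; +-monoʳ-≤; +-monoʳ-<; +-cancelˡ-≡; *-monoˡ-≤; *-monoʳ-≤;
         n∸n≡0; ∸-monoʳ-<; +-∸-assoc)
open import Data.Fin using (Fin; zero; suc; toℕ; fromℕ<; _↑ˡ_; _↑ʳ_)
open import Data.Fin.Properties using (toℕ-injective; toℕ-fromℕ<; toℕ<n; toℕ-↑ˡ; toℕ-↑ʳ)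
import Data.Fin.Properties as Fin
open import Data.Vec using (Vec; []; _∷_; lookup; replicate) renaming (_++_ to _++ⱽ_)
open import Data.List using (List; []; _∷_; map; length; _++_; filter)
open import Data.List.Properties using (length-++)
open import Data.List.Membership.Propositional using (_∈_; _∉_; find; lose)
open import Data.List.Membership.Propositional.Properties
  using (∈-map⁺; ∈-map⁻; ∈-++⁺ˡ; ∈-++⁺ʳ; ∈-++⁻; ∈-filter⁺; ∈-filter⁻)
open import Data.List.Relation.Unary.Any using (here; there; any?)
open import Data.Bool using (Bool; true; false; _∧_; _∨_; not) renaming (_≟_ to _≟ᴮ_)
open import Data.Bool.Properties using (∨-identityʳ; ∧-zeroʳ; ∨-idem; ∧-idem; ¬-not; ∨-conicalˡ; ∨-conicalʳ)
open import Data.Sum using (_⊎_; inj₁; inj₂; [_,_])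
import Data.Sum as Sum
open import Data.Product using (Σ; _×_; _,_; proj₁; proj₂)
open import Data.Empty using (⊥; ⊥-elim)
open import Data.Unit using (⊤; tt)
open import Function using (_∘_)
open import Relation.Binary.PropositionalEquality using (_≡_; _≢_; refl; sym; trans; cong; cong₂; subst; subst₂; module ≡-Reasoning)
open import Relation.Nullary using (¬_; Dec; yes; no)
open import Relation.Nullary.Decidable using (¬?; map′; _×-dec_)

pos-injective : ∀ {V : Set} {x y : V} → pos x ≡ pos y → x ≡ y
pos-injective refl = refl

neg-injective : ∀ {V : Set} {x y : V} → neg x ≡ neg y → x ≡ y
neg-injective refl = refl

Lit-≟ : ∀ {m} (a b : Lit (Fin m)) → Dec (a ≡ b)
Lit-≟ (pos x) (pos y) = map′ (cong pos) pos-injective (x Fin.≟ y)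
Lit-≟ (neg x) (neg y) = map′ (cong neg) neg-injective (x Fin.≟ y)
Lit-≟ (pos x) (neg y) = no λ ()
Lit-≟ (neg x) (pos y) = no λ ()

compl-≢ : ∀ {V : Set} (l : Lit V) → l ≢ compl l
compl-≢ (pos x) ()
compl-≢ (neg x) ()

var-compl : ∀ {V : Set} (l : Lit V) → var (compl l) ≡ var l
var-compl (pos x) = refl
var-compl (neg x) = refl

nonTaut-compl : ∀ {V : Set} {Φ : CNF V} {C} → NonTautCNF Φ → C ∈ Φ → ∀ l → l ∈ C → compl l ∈ C → ⊥
nonTaut-compl nt C∈ (pos x) p n = nt C∈ x (p , n)
nonTaut-compl nt C∈ (neg x) n p = nt C∈ x (p , n)

nonTaut-map : ∀ {V W : Set} (e : V → W) → (∀ {a b} → e a ≡ e b → a ≡ b) →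
              (Φ : CNF V) → NonTautCNF Φ → NonTautCNF (map (map (mapLit e)) Φ)
nonTaut-map e e-inj Φ nt C'∈ x (p , q) with ∈-map⁻ (map (mapLit e)) C'∈
... | C , C∈ , refl with ∈-map⁻ (mapLit e) p | ∈-map⁻ (mapLit e) q
...   | pos y , y∈ , e₁ | neg y' , y'∈ , e₂ =
          nt C∈ y (y∈ , subst (λ z → neg z ∈ C) (e-inj (trans (sym (neg-injective e₂)) (pos-injective e₁))) y'∈)
...   | neg y , _ , () | _
...   | pos y , _ , _ | pos y' , _ , ()

var-∈-mapLit : ∀ {V W : Set} (e : V → W) (Φ : CNF V) {C l} → C ∈ map (map (mapLit e)) Φ → l ∈ C → Σ V λ v → var l ≡ e v
var-∈-mapLit e Φ C∈ l∈ with ∈-map⁻ (map (mapLit e)) C∈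
... | _ , _ , refl with ∈-map⁻ (mapLit e) l∈
...   | pos y , _ , refl = y , refl
...   | neg y , _ , refl = y , refl

evalLit-map : ∀ {V W : Set} (e : V → W) (β : W → Bool) l → evalLit β (mapLit e l) ≡ evalLit (β ∘ e) l
evalLit-map e β (pos x) = refl
evalLit-map e β (neg x) = refl

evalCNF-map : ∀ {V W : Set} (e : V → W) (β : W → Bool) Φ →
              evalCNF β (map (map (mapLit e)) Φ) ≡ evalCNF (β ∘ e) Φ
evalCNF-map e β [] = refl
evalCNF-map e β (C ∷ Φ) = cong₂ _∧_ (evalClause-map C) (evalCNF-map e β Φ)
  where
    evalClause-map : ∀ C → evalClause β (map (mapLit e) C) ≡ evalClause (β ∘ e) C
    evalClause-map [] = refl
    evalClause-map (l ∷ C) = cong₂ _∨_ (evalLit-map e β l) (evalClause-map C)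

evalLit-cong : ∀ {V : Set} {β β' : V → Bool} → (∀ v → β v ≡ β' v) → ∀ l → evalLit β l ≡ evalLit β' l
evalLit-cong h (pos x) = h x
evalLit-cong h (neg x) = cong not (h x)

evalCNF-cong : ∀ {V : Set} {β β' : V → Bool} → (∀ v → β v ≡ β' v) → ∀ Φ → evalCNF β Φ ≡ evalCNF β' Φ
evalCNF-cong h [] = refl
evalCNF-cong {β = β} {β'} h (C ∷ Φ) = cong₂ _∧_ (evalClause-cong C) (evalCNF-cong h Φ)
  where
    evalClause-cong : ∀ C → evalClause β C ≡ evalClause β' C
    evalClause-cong [] = refl
    evalClause-cong (l ∷ C) = cong₂ _∨_ (evalLit-cong h l) (evalClause-cong C)

evalClause-false : ∀ {V : Set} (β : V → Bool) C → (∀ {l} → l ∈ C → evalLit β l ≡ false) → evalClause β C ≡ false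
evalClause-false β [] h = refl
evalClause-false β (l ∷ C) h rewrite h (here refl) = evalClause-false β C (h ∘ there)

evalCNF-false : ∀ {V : Set} (β : V → Bool) {C} Φ → C ∈ Φ → evalClause β C ≡ false → evalCNF β Φ ≡ false
evalCNF-false β (C ∷ Φ) (here refl) e rewrite e = refl
evalCNF-false β (D ∷ Φ) (there p) e rewrite evalCNF-false β Φ p e = ∧-zeroʳ _

-- Evaluating a prefix level by level

update : ∀ {n} → ℕ → Bool → (Fin n → Bool) → Fin n → Bool
update k b α i with toℕ i ≟ k
... | yes _ = b
... | no _ = α i

update-≡ : ∀ {n} k b (α : Fin n → Bool) i → toℕ i ≡ k → update k b α i ≡ b
update-≡ k b α i e with toℕ i ≟ k
... | yes _ = refl
... | no ne = ⊥-elim (ne e)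

update-≢ : ∀ {n} k b (α : Fin n → Bool) i → toℕ i ≢ k → update k b α i ≡ α i
update-≢ k b α i ne with toℕ i ≟ k
... | yes e = ⊥-elim (ne e)
... | no _ = refl

evalLit-update-≢ : ∀ {n} k b (α : Fin n → Bool) l → toℕ (var l) ≢ k → evalLit (update k b α) l ≡ evalLit α l
evalLit-update-≢ k b α (pos x) ne = update-≢ k b α x ne
evalLit-update-≢ k b α (neg x) ne = cong not (update-≢ k b α x ne)

-- Out of range the quantifier is a junk ∃Q; it is only ever consulted in range.
quantAt : ∀ {m} → Vec Quant m → ℕ → Quant
quantAt [] _ = ∃Q
quantAt (q ∷ v) zero = q
quantAt (q ∷ v) (suc k) = quantAt v k

quantAt-lookup : ∀ {m} (v : Vec Quant m) (i : Fin m) → lookup v i ≡ quantAt v (toℕ i)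
quantAt-lookup (q ∷ v) zero = refl
quantAt-lookup (q ∷ v) (suc i) = quantAt-lookup v i

combine-idem : ∀ Q b → combine Q b b ≡ b
combine-idem ∃Q b = ∨-idem b
combine-idem ∀Q b = ∧-idem b

evalLevels : ∀ {n} → Vec Quant n → ℕ → ℕ → ((Fin n → Bool) → Bool) → (Fin n → Bool) → Bool
evalLevels pr zero k f α = f α
evalLevels pr (suc j) k f α =
  combine (quantAt pr k) (evalLevels pr j (suc k) f (update k true α)) (evalLevels pr j (suc k) f (update k false α))

-- Lines of LQU⁺-Res up to merging

module Lines (F : QBF) where
  open QBF F
  open LQU F

  lit-injective : ∀ {a b} → lit a ≡ lit b → a ≡ b
  lit-injective refl = refl

  star-injective : ∀ {u v} → star u ≡ star v → u ≡ v
  star-injective refl = refl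

  PLit-≟ : (a b : PLit) → Dec (a ≡ b)
  PLit-≟ (lit a) (lit b) = map′ (cong lit) lit-injective (Lit-≟ a b)
  PLit-≟ (star u) (star v) = map′ (cong star) star-injective (u Fin.≟ v)
  PLit-≟ (lit _) (star _) = no λ ()
  PLit-≟ (star _) (lit _) = no λ ()

  open import Data.List.Membership.DecPropositional PLit-≟ public using (_∈?_)

  univ? : (u : Fin n) → Dec (IsUniv u)
  univ? u with lookup prefix u
  ... | ∀Q = yes refl
  ... | ∃Q = no λ ()

  univ⊎exist : (u : Fin n) → IsUniv u ⊎ IsExist u
  univ⊎exist u with lookup prefix u
  ... | ∀Q = inj₁ refl
  ... | ∃Q = inj₂ refl

  univ-exist-⊥ : (u : Fin n) → IsUniv u → IsExist u → ⊥
  univ-exist-⊥ u p q with trans (sym p) q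
  ... | ()

  _∈⋆_ : PLit → Clause → Set
  w ∈⋆ L = w ∈ L ⊎ (Σ (Lit (Fin n)) λ l → (w ≡ lit l) × (star (var l) ∈ L))

  _⊆⋆_ : Clause → Clause → Set
  L' ⊆⋆ L = ∀ {w} → w ∈ L' → w ∈⋆ L

  NonTaut : Clause → Set
  NonTaut L = ∀ l → lit l ∈ L → lit (compl l) ∈ L → ⊥

  InScope : ℕ → PLit → Set
  InScope k (lit l) = k ≤ ind (var l)
  InScope k (star u) = k < ind u × IsUniv u

  Scoped : ℕ → Clause → Set
  Scoped k L = ∀ {w} → w ∈ L → InScope k w

  inScope⇒≤ : ∀ {k} w → InScope k w → k ≤ ind (pvar w)
  inScope⇒≤ (lit l) s = s
  inScope⇒≤ (star v) (s , _) = <⇒≤ s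

  UnivRightOf : Fin n → PLit → Set
  UnivRightOf x w = IsUniv (pvar w) × ind x < ind (pvar w)

  univRightOf? : (x : Fin n) (w : PLit) → Dec (UnivRightOf x w)
  univRightOf? x w = univ? (pvar w) ×-dec (ind x <? ind (pvar w))

  univRightOf-compl⁺ : ∀ {x} l → UnivRightOf x (lit l) → UnivRightOf x (lit (compl l))
  univRightOf-compl⁺ {x} l = subst (λ v → IsUniv v × ind x < ind v) (sym (var-compl l))

  univRightOf-compl⁻ : ∀ {x} l → UnivRightOf x (lit (compl l)) → UnivRightOf x (lit l)
  univRightOf-compl⁻ {x} l = subst (λ v → IsUniv v × ind x < ind v) (var-compl l)

  SurvivesIn : Fin n → PLit → Clause → Set
  SurvivesIn x w R = w ∈ R ⊎ (UnivRightOf x w × star (pvar w) ∈ R)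

  -- Resolution on x where the resolvent only has to contain every side literal, possibly merged;
  -- unlike Resolution this is preserved when the premises are replaced by ⊆⋆-smaller clauses.
  record RelaxedRes (x : Fin n) (E₁ E₂ R : Clause) : Set where
    field
      pos∈      : lit (pos x) ∈ E₁
      neg∈      : lit (neg x) ∈ E₂
      survives₁ : ∀ {w} → w ∈ E₁ → w ≢ lit (pos x) → SurvivesIn x w R
      survives₂ : ∀ {w} → w ∈ E₂ → w ≢ lit (neg x) → SurvivesIn x w R
      clash     : ∀ {w₁ w₂} → w₁ ∈ E₁ → w₂ ∈ E₂ → w₁ ≢ lit (pos x) → w₂ ≢ lit (neg x) →
                  pvar w₁ ≡ pvar w₂ → ¬ UnivRightOf x w₁ → (w₁ ≡ w₂) × ¬ IsStar w₁

  ∈⋆-survives : ∀ {x E R p v} → (∀ {w} → w ∈ E → w ≢ lit p → SurvivesIn x w R) →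
                v ∈⋆ E → v ≢ lit p → v ∈⋆ R
  ∈⋆-survives {v = lit l} surv (inj₁ v∈) ne with surv v∈ ne
  ... | inj₁ i = inj₁ i
  ... | inj₂ (_ , s) = inj₂ (l , refl , s)
  ∈⋆-survives {v = star u} surv (inj₁ v∈) ne with surv v∈ ne
  ... | inj₁ i = inj₁ i
  ... | inj₂ (_ , s) = inj₁ s
  ∈⋆-survives surv (inj₂ (l , refl , s∈)) ne with surv s∈ (λ ())
  ... | inj₁ i = inj₂ (l , refl , i)
  ... | inj₂ (_ , s) = inj₂ (l , refl , s)

  ∈-map-lit⁻ : ∀ {l C} → lit l ∈ map lit C → l ∈ C
  ∈-map-lit⁻ {C = C} p with ∈-map⁻ lit p
  ... | l' , l'∈ , refl = l'∈

  mergeUnlessIn : Fin n → Clause → PLit → PLit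
  mergeUnlessIn x R w with w ∈? R
  ... | yes _ = w
  ... | no _ with univRightOf? x w
  ...   | yes _ = star (pvar w)
  ...   | no _ = w

  mergeUnlessIn-view : ∀ x R w →
    (mergeUnlessIn x R w ≡ w × (w ∈ R ⊎ ¬ UnivRightOf x w)) ⊎
    (mergeUnlessIn x R w ≡ star (pvar w) × (w ∉ R) × UnivRightOf x w)
  mergeUnlessIn-view x R w with w ∈? R
  ... | yes p = inj₁ (refl , inj₁ p)
  ... | no p with univRightOf? x w
  ...   | yes u = inj₂ (refl , p , u)
  ...   | no u = inj₁ (refl , inj₂ u)

  pvar-mergeUnlessIn : ∀ x R w → pvar (mergeUnlessIn x R w) ≡ pvar w
  pvar-mergeUnlessIn x R w with mergeUnlessIn-view x R w
  ... | inj₁ (e , _) = cong pvar e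
  ... | inj₂ (e , _) = cong pvar e

  mergeUnlessIn-lit : ∀ x R w l → lit l ≡ mergeUnlessIn x R w → (w ≡ lit l) × (w ∈ R ⊎ ¬ UnivRightOf x w)
  mergeUnlessIn-lit x R w l e with mergeUnlessIn-view x R w
  ... | inj₁ (e' , q) = sym (trans e e') , q
  ... | inj₂ (e' , _) with trans e e'
  ...   | ()

-- Restricted derivations and their soundness

module Restricted (F : QBF) (M : CNF (Fin (QBF.n F))) (M-nonTaut : NonTautCNF M) where
  open QBF F
  open LQU F
  open Lines F

  -- A relaxed LQU⁺-Res derivation from M restricted by α on the variables of index below k:
  -- every conclusion may be weakened, and merged literals are only tracked up to ⊆⋆.
  -- The relaxation makes the system closed under restricting one more level (restrict)
  -- while keeping it sound (falsified).
  data Der (k : ℕ) (α : Fin n → Bool) : Clause → Set where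
    ax  : ∀ {C L} → C ∈ M →
          (∀ {l} → l ∈ C → ind (var l) < k → evalLit α l ≡ false) →
          (∀ {l} → l ∈ C → k ≤ ind (var l) → lit l ∈ L) →
          NonTaut L → Scoped k L → Der k α L
    red : ∀ {E L} → Der k α E → (u : Fin n) → IsUniv u → k ≤ ind u →
          (∀ {w} → w ∈ E → IsExist (pvar w) → ind (pvar w) ≤ ind u) →
          (∀ {w} → w ∈ E → pvar w ≡ u ⊎ w ∈⋆ L) →
          NonTaut L → Scoped k L → Der k α L
    res : ∀ {E₁ E₂ R} → Der k α E₁ → Der k α E₂ → (x : Fin n) → k ≤ ind x →
          RelaxedRes x E₁ E₂ R → NonTaut R → Scoped k R → Der k α R

  der-nonTaut : ∀ {k α L} → Der k α L → NonTaut L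
  der-nonTaut (ax _ _ _ nt _) = nt
  der-nonTaut (red _ _ _ _ _ _ nt _) = nt
  der-nonTaut (res _ _ _ _ _ nt _) = nt

  der-scoped : ∀ {k α L} → Der k α L → Scoped k L
  der-scoped (ax _ _ _ _ sc) = sc
  der-scoped (red _ _ _ _ _ _ _ sc) = sc
  der-scoped (res _ _ _ _ _ _ sc) = sc

  DrawsFrom : Clause → Clause → Clause → Set
  DrawsFrom L₁ L₂ L' = ∀ {w} → w ∈ L' → Σ PLit λ w₀ → (w₀ ∈ L₁ ⊎ w₀ ∈ L₂) × (pvar w ≡ pvar w₀)

  -- If a premise lost its pivot literal it already subsumes the resolvent; otherwise resolve,
  -- merging exactly those side literals that reach R only in merged form.
  resolve-⊆⋆ : ∀ {k α x E₁ E₂ R L₁ L₂} → RelaxedRes x E₁ E₂ R → NonTaut R → k ≤ ind x →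
     Der k α L₁ → Der k α L₂ → L₁ ⊆⋆ E₁ → L₂ ⊆⋆ E₂ →
     Σ Clause λ L' → Der k α L' × L' ⊆⋆ R × DrawsFrom L₁ L₂ L'
  resolve-⊆⋆ {k} {α} {x} {E₁} {E₂} {R} {L₁} {L₂} rr ntR kx d₁ d₂ s₁ s₂
    with lit (pos x) ∈? L₁ | lit (neg x) ∈? L₂
  ... | no p∉ | _ =
    L₁ , d₁ , (λ w∈ → ∈⋆-survives (RelaxedRes.survives₁ rr) (s₁ w∈) (λ e → p∉ (subst (_∈ L₁) e w∈))) ,
    λ {w} w∈ → w , inj₁ w∈ , refl
  ... | yes _ | no n∉ =
    L₂ , d₂ , (λ w∈ → ∈⋆-survives (RelaxedRes.survives₂ rr) (s₂ w∈) (λ e → n∉ (subst (_∈ L₂) e w∈))) ,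
    λ {w} w∈ → w , inj₂ w∈ , refl
  ... | yes p∈ | yes n∈ = R' , res d₁ d₂ x kx rr' ntR' scR' , subR' , drawsR'
    where
      notLit : (l : Lit (Fin n)) (w : PLit) → Dec (w ≢ lit l)
      notLit l w = ¬? (PLit-≟ w (lit l))

      Ls : Clause
      Ls = filter (notLit (pos x)) L₁ ++ filter (notLit (neg x)) L₂

      R' : Clause
      R' = map (mergeUnlessIn x R) Ls

      Ls-in₁ : ∀ {w} → w ∈ L₁ → w ≢ lit (pos x) → w ∈ Ls
      Ls-in₁ w∈ ne = ∈-++⁺ˡ (∈-filter⁺ (notLit (pos x)) w∈ ne)

      Ls-in₂ : ∀ {w} → w ∈ L₂ → w ≢ lit (neg x) → w ∈ Ls
      Ls-in₂ w∈ ne = ∈-++⁺ʳ (filter (notLit (pos x)) L₁) (∈-filter⁺ (notLit (neg x)) w∈ ne)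

      Ls-out : ∀ {w} → w ∈ Ls → (w ∈ L₁ × w ≢ lit (pos x)) ⊎ (w ∈ L₂ × w ≢ lit (neg x))
      Ls-out w∈ with ∈-++⁻ (filter (notLit (pos x)) L₁) w∈
      ... | inj₁ a = inj₁ (∈-filter⁻ (notLit (pos x)) a)
      ... | inj₂ b = inj₂ (∈-filter⁻ (notLit (neg x)) b)

      Ls-⊆⋆ : Ls ⊆⋆ R
      Ls-⊆⋆ w∈ with Ls-out w∈
      ... | inj₁ (a , ne) = ∈⋆-survives (RelaxedRes.survives₁ rr) (s₁ a) ne
      ... | inj₂ (b , ne) = ∈⋆-survives (RelaxedRes.survives₂ rr) (s₂ b) ne

      survives' : ∀ {w} → w ∈ Ls → SurvivesIn x w R'
      survives' {w} w∈ with mergeUnlessIn-view x R w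
      ... | inj₁ (e , _) = inj₁ (subst (_∈ R') e (∈-map⁺ (mergeUnlessIn x R) w∈))
      ... | inj₂ (e , _ , ub) = inj₂ (ub , subst (_∈ R') e (∈-map⁺ (mergeUnlessIn x R) w∈))

      clash' : ∀ {w₁ w₂} → w₁ ∈ L₁ → w₂ ∈ L₂ → w₁ ≢ lit (pos x) → w₂ ≢ lit (neg x) →
               pvar w₁ ≡ pvar w₂ → ¬ UnivRightOf x w₁ → (w₁ ≡ w₂) × ¬ IsStar w₁
      clash' a b ne₁ ne₂ eq nub with s₁ a | s₂ b
      ... | inj₁ a' | inj₁ b' = RelaxedRes.clash rr a' b' ne₁ ne₂ eq nub
      ... | inj₂ (l , refl , s) | inj₁ b' = ⊥-elim (proj₂ (RelaxedRes.clash rr s b' (λ ()) ne₂ eq nub) tt)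
      ... | inj₁ a' | inj₂ (l , refl , s) with RelaxedRes.clash rr a' s ne₁ (λ ()) eq nub
      ...   | refl , ns = ⊥-elim (ns tt)
      clash' a b ne₁ ne₂ eq nub | inj₂ (l , refl , s) | inj₂ (l₂ , refl , s') =
        ⊥-elim (proj₂ (RelaxedRes.clash rr s s' (λ ()) (λ ()) eq nub) tt)

      rr' : RelaxedRes x L₁ L₂ R'
      rr' = record
        { pos∈ = p∈ ; neg∈ = n∈
        ; survives₁ = λ w∈ ne → survives' (Ls-in₁ w∈ ne)
        ; survives₂ = λ w∈ ne → survives' (Ls-in₂ w∈ ne)
        ; clash = clash' }

      unlit : Lit (Fin n) → PLit → Lit (Fin n)
      unlit _ (lit z) = z
      unlit d (star _) = d

      nonTaut-Ls : ∀ l → lit l ∈ Ls → lit (compl l) ∈ Ls → ¬ UnivRightOf x (lit l) → ⊥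
      nonTaut-Ls l a b nu with Ls-out a | Ls-out b
      ... | inj₁ (a' , _) | inj₁ (b' , _) = der-nonTaut d₁ l a' b'
      ... | inj₂ (a' , _) | inj₂ (b' , _) = der-nonTaut d₂ l a' b'
      ... | inj₁ (a' , na) | inj₂ (b' , nb) =
        compl-≢ l (cong (unlit l) (proj₁ (clash' a' b' na nb (sym (var-compl l)) nu)))
      ... | inj₂ (a' , na) | inj₁ (b' , nb) =
        compl-≢ l (sym (cong (unlit l) (proj₁ (clash' b' a' nb na (var-compl l) (nu ∘ univRightOf-compl⁻ l)))))

      ntR' : NonTaut R'
      ntR' l a b with ∈-map⁻ (mergeUnlessIn x R) a | ∈-map⁻ (mergeUnlessIn x R) b
      ... | w , w∈ , e | w' , w'∈ , e' with mergeUnlessIn-lit x R w l e | mergeUnlessIn-lit x R w' (compl l) e'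
      ...   | refl , inj₁ r | refl , inj₁ r' = ntR l r r'
      ...   | refl , inj₂ nu | refl , _ = nonTaut-Ls l w∈ w'∈ nu
      ...   | refl , inj₁ _ | refl , inj₂ nu = nonTaut-Ls l w∈ w'∈ (nu ∘ univRightOf-compl⁺ l)

      scLs : ∀ {w} → w ∈ Ls → InScope k w
      scLs w∈ with Ls-out w∈
      ... | inj₁ (a , _) = der-scoped d₁ a
      ... | inj₂ (b , _) = der-scoped d₂ b

      scR' : Scoped k R'
      scR' a with ∈-map⁻ (mergeUnlessIn x R) a
      ... | w , w∈ , refl with mergeUnlessIn-view x R w
      ...   | inj₁ (e , _) = subst (InScope k) (sym e) (scLs w∈)
      ...   | inj₂ (e , _ , (u , b)) = subst (InScope k) (sym e) (≤-<-trans kx b , u)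

      subR' : R' ⊆⋆ R
      subR' a with ∈-map⁻ (mergeUnlessIn x R) a
      ... | w , w∈ , refl with mergeUnlessIn-view x R w
      ...   | inj₁ (e , _) = subst (_∈⋆ R) (sym e) (Ls-⊆⋆ w∈)
      ...   | inj₂ (e , w∉ , _) with Ls-⊆⋆ w∈
      ...     | inj₁ i = ⊥-elim (w∉ i)
      ...     | inj₂ (l , refl , s) = inj₁ (subst (_∈ R) (sym e) s)

      drawsR' : DrawsFrom L₁ L₂ R'
      drawsR' a with ∈-map⁻ (mergeUnlessIn x R) a
      ... | w , w∈ , refl with Ls-out w∈
      ...   | inj₁ (a' , _) = w , inj₁ a' , pvar-mergeUnlessIn x R w
      ...   | inj₂ (b' , _) = w , inj₂ b' , pvar-mergeUnlessIn x R w

  TrueLitAt : ℕ → (Fin n → Bool) → Clause → Set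
  TrueLitAt k β L = Σ (Lit (Fin n)) λ l → lit l ∈ L × ind (var l) ≡ k × evalLit β l ≡ true

  Restriction : ℕ → (Fin n → Bool) → Clause → Set
  Restriction k β L = TrueLitAt k β L ⊎ Σ Clause λ L' → Der (suc k) β L' × L' ⊆⋆ L

  NoReductionAt : ∀ {k α L} → Der k α L → Set
  NoReductionAt (ax _ _ _ _ _) = ⊤
  NoReductionAt {k} (red d u _ _ _ _ _ _) = (ind u ≢ k) × NoReductionAt d
  NoReductionAt (res d₁ d₂ _ _ _ _ _) = NoReductionAt d₁ × NoReductionAt d₂

  noReductionAt-all : ∀ {k α L} → (∀ u → IsUniv u → ind u ≢ k) → (d : Der k α L) → NoReductionAt d
  noReductionAt-all h (ax _ _ _ _ _) = tt
  noReductionAt-all h (red d u uu _ _ _ _ _) = h u uu , noReductionAt-all h d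
  noReductionAt-all h (res d₁ d₂ _ _ _ _ _) = noReductionAt-all h d₁ , noReductionAt-all h d₂

  restrict-ax : ∀ {k α C L} b → C ∈ M →
    (∀ {l} → l ∈ C → ind (var l) < k → evalLit α l ≡ false) →
    (∀ {l} → l ∈ C → k ≤ ind (var l) → lit l ∈ L) → Restriction k (update k b α) L
  restrict-ax {k} {α} {C} {L} b C∈ hf hin
    with any? (λ l → (ind (var l) ≟ k) ×-dec (evalLit (update k b α) l ≟ᴮ true)) C
  ... | yes an with find an
  ...   | l , l∈ , (e , ev) = inj₁ (l , hin l∈ (≤-reflexive (sym e)) , e , ev)
  restrict-ax {k} {α} {C} {L} b C∈ hf hin | no nan = inj₂ (L' , ax C∈ hf' hin' nt' sc' , sub')
    where
      deeper? : (l : Lit (Fin n)) → Dec (suc k ≤ ind (var l))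
      deeper? l = suc k ≤? ind (var l)

      L' : Clause
      L' = map lit (filter deeper? C)

      hf' : ∀ {l} → l ∈ C → ind (var l) < suc k → evalLit (update k b α) l ≡ false
      hf' {l} l∈ lt with ind (var l) ≟ k
      ... | yes e = ¬-not (λ ev → nan (lose l∈ (e , ev)))
      ... | no ne = trans (evalLit-update-≢ k b α l ne) (hf l∈ (≤∧≢⇒< (≤-pred lt) ne))

      hin' : ∀ {l} → l ∈ C → suc k ≤ ind (var l) → lit l ∈ L'
      hin' l∈ le = ∈-map⁺ lit (∈-filter⁺ deeper? l∈ le)

      C-part : ∀ {l} → lit l ∈ L' → l ∈ C × suc k ≤ ind (var l)
      C-part a = ∈-filter⁻ deeper? {xs = C} (∈-map-lit⁻ a)

      nt' : NonTaut L'
      nt' l a b' = nonTaut-compl M-nonTaut C∈ l (proj₁ (C-part a)) (proj₁ (C-part b'))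

      sc' : Scoped (suc k) L'
      sc' w∈ with ∈-map⁻ lit w∈
      ... | l , l∈ , refl = proj₂ (∈-filter⁻ deeper? {xs = C} l∈)

      sub' : L' ⊆⋆ L
      sub' w∈ with ∈-map⁻ lit w∈
      ... | l , l∈ , refl with ∈-filter⁻ deeper? {xs = C} l∈
      ...   | l∈C , le = inj₁ (hin l∈C (<⇒≤ le))

  restrict-red : ∀ {k β E L} (u : Fin n) → IsUniv u → k ≤ ind u → ind u ≢ k →
    (∀ {w} → w ∈ E → IsExist (pvar w) → ind (pvar w) ≤ ind u) →
    (∀ {w} → w ∈ E → pvar w ≡ u ⊎ w ∈⋆ L) → Scoped k L →
    Restriction k β E → Restriction k β L
  restrict-red u uu ku ne ord cov sc (inj₁ (l , l∈ , e , ev)) with cov l∈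
  ... | inj₁ eu = ⊥-elim (ne (trans (cong toℕ (sym eu)) e))
  ... | inj₂ (inj₁ i) = inj₁ (l , i , e , ev)
  ... | inj₂ (inj₂ (_ , refl , s)) = ⊥-elim (<-irrefl (sym e) (proj₁ (sc s)))
  restrict-red {L = L} u uu ku ne ord cov sc (inj₂ (LE , d' , sub)) =
    inj₂ (L' , red d' u uu (≤∧≢⇒< ku (ne ∘ sym)) ord' cov' nt' sc' , sub')
    where
      notU? : (w : PLit) → Dec (pvar w ≢ u)
      notU? w = ¬? (pvar w Fin.≟ u)

      L' : Clause
      L' = filter notU? LE

      ord' : ∀ {w} → w ∈ LE → IsExist (pvar w) → ind (pvar w) ≤ ind u
      ord' w∈ ie with sub w∈
      ... | inj₁ i = ord i ie
      ... | inj₂ (_ , refl , s) = ord s ie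

      cov' : ∀ {w} → w ∈ LE → pvar w ≡ u ⊎ w ∈⋆ L'
      cov' {w} w∈ with pvar w Fin.≟ u
      ... | yes e = inj₁ e
      ... | no n' = inj₂ (inj₁ (∈-filter⁺ notU? w∈ n'))

      nt' : NonTaut L'
      nt' l a b' = der-nonTaut d' l (proj₁ (∈-filter⁻ notU? a)) (proj₁ (∈-filter⁻ notU? b'))

      sc' : Scoped (suc _) L'
      sc' a = der-scoped d' (proj₁ (∈-filter⁻ notU? a))

      sub' : L' ⊆⋆ L
      sub' a with ∈-filter⁻ notU? a
      ... | a' , n' with sub a'
      ...   | inj₁ i with cov i
      ...     | inj₁ e = ⊥-elim (n' e)
      ...     | inj₂ q = q
      sub' a | a' , n' | inj₂ (l , refl , s) with cov s
      ...     | inj₁ e = ⊥-elim (n' e)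
      ...     | inj₂ (inj₁ s') = inj₂ (l , refl , s')
      ...     | inj₂ (inj₂ (_ , () , _))

  restrict-premise : ∀ {k β x E R} (l : Lit (Fin n)) → var l ≡ x → ind x ≡ k → evalLit β l ≡ false →
    (∀ {w} → w ∈ E → w ≢ lit l → SurvivesIn x w R) → Restriction k β E → Restriction k β R
  restrict-premise {β = β} l refl ix ev surv (inj₁ (l' , l'∈ , e , ev')) with surv l'∈ l'≢l
    where
      l'≢l : lit l' ≢ lit l
      l'≢l q with trans (sym ev') (trans (cong (evalLit β) (lit-injective q)) ev)
      ... | ()
  ... | inj₁ i = inj₁ (l' , i , e , ev')
  ... | inj₂ ((_ , lt) , _) = ⊥-elim (<-irrefl (trans ix (sym e)) lt)
  restrict-premise l refl ix ev surv (inj₂ (L' , d' , sub)) =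
    inj₂ (L' , d' , λ w∈ → ∈⋆-survives surv (sub w∈) (pivotFree w∈))
    where
      pivotFree : ∀ {w} → w ∈ L' → w ≢ lit l
      pivotFree w∈ refl = <-irrefl (sym ix) (der-scoped d' w∈)

  restrict-pivot : ∀ {k α x E₁ E₂ R} b → ind x ≡ k → RelaxedRes x E₁ E₂ R →
    Restriction k (update k b α) E₁ → Restriction k (update k b α) E₂ → Restriction k (update k b α) R
  restrict-pivot {k} {α} {x} true ix rr _ r₂ =
    restrict-premise (neg x) refl ix (cong not (update-≡ k true α x ix)) (RelaxedRes.survives₂ rr) r₂
  restrict-pivot {k} {α} {x} false ix rr r₁ _ =
    restrict-premise (pos x) refl ix (update-≡ k false α x ix) (RelaxedRes.survives₁ rr) r₁

  trueLit-survives : ∀ {k β x E R} (p : Lit (Fin n)) → var p ≡ x → ind x ≢ k → Scoped k R →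
    (∀ {w} → w ∈ E → w ≢ lit p → SurvivesIn x w R) → TrueLitAt k β E → TrueLitAt k β R
  trueLit-survives p refl nx sc surv (l , l∈ , e , ev) with surv l∈ (λ q → nx (trans (cong (ind ∘ pvar) (sym q)) e))
  ... | inj₁ i = l , i , e , ev
  ... | inj₂ (_ , s) = ⊥-elim (<-irrefl (sym e) (proj₁ (sc s)))

  restrict-nonpivot : ∀ {k β x E₁ E₂ R} → k ≤ ind x → ind x ≢ k → RelaxedRes x E₁ E₂ R → NonTaut R → Scoped k R →
    Restriction k β E₁ → Restriction k β E₂ → Restriction k β R
  restrict-nonpivot {x = x} kx nx rr nt sc (inj₁ tl) _ =
    inj₁ (trueLit-survives (pos x) refl nx sc (RelaxedRes.survives₁ rr) tl)
  restrict-nonpivot {x = x} kx nx rr nt sc (inj₂ _) (inj₁ tl) =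
    inj₁ (trueLit-survives (neg x) refl nx sc (RelaxedRes.survives₂ rr) tl)
  restrict-nonpivot kx nx rr nt sc (inj₂ (L₁ , d₁ , s₁)) (inj₂ (L₂ , d₂ , s₂))
    with resolve-⊆⋆ rr nt (≤∧≢⇒< kx (nx ∘ sym)) d₁ d₂ s₁ s₂
  ... | L' , d' , sub , _ = inj₂ (L' , d' , sub)

  restrict : ∀ {k α L} (b : Bool) (d : Der k α L) → NoReductionAt d → Restriction k (update k b α) L
  restrict b (ax C∈ hf hin _ _) _ = restrict-ax b C∈ hf hin
  restrict b (red d u uu ku ord cov _ sc) (ne , nd) = restrict-red u uu ku ne ord cov sc (restrict b d nd)
  restrict {k} b (res d₁ d₂ x kx rr nt sc) (n₁ , n₂) with ind x ≟ k
  ... | yes ix = restrict-pivot b ix rr (restrict b d₁ n₁) (restrict b d₂ n₂)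
  ... | no nx = restrict-nonpivot kx nx rr nt sc (restrict b d₁ n₁) (restrict b d₂ n₂)

  AllUniversal : Clause → Set
  AllUniversal L = ∀ {w} → w ∈ L → IsUniv (pvar w)

  allUniversal-⊆⋆ : ∀ {L' L} → L' ⊆⋆ L → AllUniversal L → AllUniversal L'
  allUniversal-⊆⋆ sub uo w∈ with sub w∈
  ... | inj₁ i = uo i
  ... | inj₂ (_ , refl , s) = uo s

  -- A reduction of the level-k variable u needs a premise whose existential literals lie at or below
  -- level k, hence (being scoped) nowhere: that premise consists of universal literals only.
  noReductionAt⊎universalPremise : ∀ {k α L} (d : Der k α L) →
    NoReductionAt d ⊎ Σ Clause λ E → Σ (Der k α E) λ d' → AllUniversal E × NoReductionAt d'
  noReductionAt⊎universalPremise (ax _ _ _ _ _) = inj₁ tt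
  noReductionAt⊎universalPremise {k} (red {E} d u uu ku ord _ _ _) with noReductionAt⊎universalPremise d
  ... | inj₂ r = inj₂ r
  ... | inj₁ nd with ind u ≟ k
  ...   | no ne = inj₁ (ne , nd)
  ...   | yes e = inj₂ (E , d , universal , nd)
    where
      universal : AllUniversal E
      universal {w} w∈ with univ⊎exist (pvar w)
      ... | inj₁ un = un
      ... | inj₂ ex = ⊥-elim (univ-exist-⊥ u uu (subst IsExist (toℕ-injective (trans ind≡ (sym e))) ex))
        where
          ind≡ : ind (pvar w) ≡ k
          ind≡ = ≤-antisym (subst (ind (pvar w) ≤_) e (ord w∈ ex)) (inScope⇒≤ w (der-scoped d w∈))
  noReductionAt⊎universalPremise (res d₁ d₂ _ _ _ _ _)
    with noReductionAt⊎universalPremise d₁ | noReductionAt⊎universalPremise d₂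
  ... | inj₂ r | _ = inj₂ r
  ... | inj₁ _ | inj₂ r = inj₂ r
  ... | inj₁ n₁ | inj₁ n₂ = inj₁ (n₁ , n₂)

  evalM : (Fin n → Bool) → Bool
  evalM β = evalCNF β M

  Falsified : ℕ → ℕ → Set
  Falsified j k = ∀ α L → Der k α L → AllUniversal L → evalLevels prefix j k evalM α ≡ false

  falsified-last : ∀ {k} → k ≡ n → Falsified 0 k
  falsified-last e α L (ax {C} C∈ hf _ _ _) _ =
    evalCNF-false α M C∈ (evalClause-false α C (λ {l} l∈ → hf l∈ (ind<k (var l))))
    where
      ind<k : ∀ i → ind i < _
      ind<k i = subst (ind i <_) (sym e) (toℕ<n i)
  falsified-last e α L (red _ u _ ku _ _ _ _) _ = ⊥-elim (<-irrefl refl (≤-<-trans ku (subst (ind u <_) (sym e) (toℕ<n u))))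
  falsified-last e α L (res _ _ x kx _ _ _) _ = ⊥-elim (<-irrefl refl (≤-<-trans kx (subst (ind x <_) (sym e) (toℕ<n x))))

  falsified-∃ : ∀ {j k} (x : Fin n) → ind x ≡ k → IsExist x → Falsified j (suc k) → Falsified (suc j) k
  falsified-∃ {j} {k} x ix ex IH α L d uo =
    trans (cong₂ (combine (quantAt prefix k)) (branch true) (branch false)) (combine-idem (quantAt prefix k) false)
    where
      noRed : NoReductionAt d
      noRed = noReductionAt-all (λ u uu eq → univ-exist-⊥ u uu (subst IsExist (toℕ-injective (trans ix (sym eq))) ex)) d

      branch : ∀ b → evalLevels prefix j (suc k) evalM (update k b α) ≡ false
      branch b with restrict b d noRed
      ... | inj₁ (l , l∈ , e , _) = ⊥-elim (univ-exist-⊥ x (subst IsUniv (toℕ-injective (trans e (sym ix))) (uo l∈)) ex)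
      ... | inj₂ (L' , d' , sub) = IH _ L' d' (allUniversal-⊆⋆ sub uo)

  -- The universal player falsifies the literal on x (if any) of a clause of universal literals
  -- whose derivation reduces nothing at this level.
  falsified-universal : ∀ {j k E} (x : Fin n) → ind x ≡ k → IsUniv x → Falsified j (suc k) →
                        ∀ α (dE : Der k α E) → AllUniversal E → NoReductionAt dE → evalLevels prefix (suc j) k evalM α ≡ false
  falsified-universal {j} {k} {E} x ix un IH α dE uoE ndE = goal
    where
      V : Bool → Bool
      V b = evalLevels prefix j (suc k) evalM (update k b α)

      branch : ∀ b → (lit (pos x) ∈ E → b ≡ false) → (lit (pos x) ∉ E → b ≡ true) → V b ≡ false
      branch b h₁ h₂ with restrict b dE ndE
      ... | inj₂ (L' , d' , sub) = IH _ L' d' (allUniversal-⊆⋆ sub uoE)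
      ... | inj₁ (l , l∈ , e , ev) = ⊥-elim (noTrueLit l (toℕ-injective (trans e (sym ix))) l∈ ev)
        where
          noTrueLit : ∀ l → var l ≡ x → lit l ∈ E → evalLit (update k b α) l ≡ true → ⊥
          noTrueLit (pos .x) refl l∈ ev with trans (sym ev) (trans (update-≡ k b α x ix) (h₁ l∈))
          ... | ()
          noTrueLit (neg .x) refl l∈ ev with lit (pos x) ∈? E
          ... | yes p∈ = der-nonTaut dE (pos x) p∈ l∈
          ... | no p∉ with trans (sym ev) (cong not (trans (update-≡ k b α x ix) (h₂ p∉)))
          ...   | ()

      isForall : quantAt prefix k ≡ ∀Q
      isForall = trans (sym (trans (quantAt-lookup prefix x) (cong (quantAt prefix) ix))) un

      open ≡-Reasoning

      goal : evalLevels prefix (suc j) k evalM α ≡ false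
      goal with lit (pos x) ∈? E
      ... | yes p∈ = begin
        combine (quantAt prefix k) (V true) (V false) ≡⟨ cong (λ Q → combine Q (V true) (V false)) isForall ⟩
        V true ∧ V false                              ≡⟨ cong (V true ∧_) (branch false (λ _ → refl) (λ p∉ → ⊥-elim (p∉ p∈))) ⟩
        V true ∧ false                                ≡⟨ ∧-zeroʳ (V true) ⟩
        false                                         ∎
      ... | no p∉ = begin
        combine (quantAt prefix k) (V true) (V false) ≡⟨ cong (λ Q → combine Q (V true) (V false)) isForall ⟩
        V true ∧ V false                              ≡⟨ cong (_∧ V false) (branch true (λ p∈ → ⊥-elim (p∉ p∈)) (λ _ → refl)) ⟩
        false                                         ∎

  falsified-∀ : ∀ {j k} (x : Fin n) → ind x ≡ k → IsUniv x → Falsified j (suc k) → Falsified (suc j) k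
  falsified-∀ {j} x ix un IH α L d uo with noReductionAt⊎universalPremise d
  ... | inj₁ nd = falsified-universal {j} x ix un IH α d uo nd
  ... | inj₂ (E , dE , uoE , ndE) = falsified-universal {j} x ix un IH α dE uoE ndE

  falsified : ∀ j k → j + k ≡ n → Falsified j k
  falsified zero k e = falsified-last e
  falsified (suc j) k e = byQuantifier (univ⊎exist x)
    where
      k<n : k < n
      k<n = subst (k <_) e (m<n+m k (s≤s z≤n))
      x = fromℕ< k<n
      ix : ind x ≡ k
      ix = toℕ-fromℕ< k<n
      IH : Falsified j (suc k)
      IH = falsified j (suc k) (trans (+-suc j k) e)
      byQuantifier : IsUniv x ⊎ IsExist x → Falsified (suc j) k
      byQuantifier (inj₁ un) = falsified-∀ {j} x ix un IH
      byQuantifier (inj₂ ex) = falsified-∃ {j} x ix ex IH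

-- Level-by-level evaluation agrees with evalQ

evalQ-cong : ∀ {m} (qs : Vec Quant m) {h₁ h₂} → (∀ ρ → h₁ ρ ≡ h₂ ρ) → evalQ qs h₁ ≡ evalQ qs h₂
evalQ-cong [] e = e _
evalQ-cong (Q ∷ qs) e = cong₂ (combine Q) (evalQ-cong qs (λ ρ → e _)) (evalQ-cong qs (λ ρ → e _))

module LevelEvaluation {n : ℕ} (pr : Vec Quant n) where

  assign : ∀ {m} → ℕ → (Fin m → Bool) → (Fin n → Bool) → Fin n → Bool
  assign {zero} k ρ α = α
  assign {suc m} k ρ α = assign (suc k) (ρ ∘ suc) (update k (ρ zero) α)

  QuantsAt : ∀ {m} → ℕ → Vec Quant m → Set
  QuantsAt k [] = ⊤
  QuantsAt k (Q ∷ qs) = (quantAt pr k ≡ Q) × QuantsAt (suc k) qs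

  evalLevels-evalQ : ∀ {m} (qs : Vec Quant m) k g α → QuantsAt k qs →
                     evalLevels pr m k g α ≡ evalQ qs (λ ρ → g (assign k ρ α))
  evalLevels-evalQ [] k g α _ = refl
  evalLevels-evalQ (Q ∷ qs) k g α (refl , h) =
    cong₂ (combine Q) (evalLevels-evalQ qs (suc k) g (update k true α) h) (evalLevels-evalQ qs (suc k) g (update k false α) h)

  evalLevels-+ : ∀ m j k f α → evalLevels pr (m + j) k f α ≡ evalLevels pr m k (evalLevels pr j (m + k) f) α
  evalLevels-+ zero j k f α = refl
  evalLevels-+ (suc m) j k f α = cong₂ (combine (quantAt pr k)) (step true) (step false)
    where
      step : ∀ b → evalLevels pr (m + j) (suc k) f (update k b α) ≡
                   evalLevels pr m (suc k) (evalLevels pr j (suc m + k) f) (update k b α)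
      step b = subst (λ z → evalLevels pr (m + j) (suc k) f (update k b α) ≡ evalLevels pr m (suc k) (evalLevels pr j z f) (update k b α))
                     (+-suc m k) (evalLevels-+ m j (suc k) f (update k b α))

  Outside : ℕ → ℕ → Fin n → Set
  Outside lo hi i = toℕ i < lo ⊎ hi ≤ toℕ i

  Ignores : ℕ → ℕ → ((Fin n → Bool) → Bool) → Set
  Ignores lo hi g = ∀ α β → (∀ i → Outside lo hi i → α i ≡ β i) → g α ≡ g β

  update-agree : ∀ {lo hi} k b {α β : Fin n → Bool} → (∀ i → Outside lo hi i → α i ≡ β i) →
                 ∀ i → Outside lo hi i → update k b α i ≡ update k b β i
  update-agree k b h i o with toℕ i ≟ k
  ... | yes _ = refl
  ... | no _ = h i o

  evalLevels-ignores : ∀ {lo hi} j k f → Ignores lo hi f → hi ≤ k → Ignores lo hi (evalLevels pr j k f)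
  evalLevels-ignores zero k f ign le = ign
  evalLevels-ignores (suc j) k f ign le α β h =
    cong₂ (combine (quantAt pr k))
      (evalLevels-ignores j (suc k) f ign (m≤n⇒m≤1+n le) _ _ (update-agree k true h))
      (evalLevels-ignores j (suc k) f ign (m≤n⇒m≤1+n le) _ _ (update-agree k false h))

  outside-suc : ∀ {k m i} → Outside k (k + suc m) i → Outside (suc k) (suc k + m) i
  outside-suc {k} {m} {i} = Sum.map m<n⇒m<1+n (subst (_≤ toℕ i) (+-suc k m))

  outside-≢ : ∀ {k m i} → Outside k (k + suc m) i → toℕ i ≢ k
  outside-≢ (inj₁ lt) e = <-irrefl e lt
  outside-≢ {k} {m} (inj₂ le) refl = <-irrefl refl (<-≤-trans (subst (k <_) (sym (+-suc k m)) (s≤s (m≤m+n k m))) le)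

  evalLevels-ignored : ∀ m k g α → Ignores k (k + m) g → evalLevels pr m k g α ≡ g α
  evalLevels-ignored zero k g α ign = refl
  evalLevels-ignored (suc m) k g α ign =
    trans (cong₂ (combine (quantAt pr k)) (step true) (step false)) (combine-idem (quantAt pr k) (g α))
    where
      step : ∀ b → evalLevels pr m (suc k) g (update k b α) ≡ g α
      step b = trans (evalLevels-ignored m (suc k) g (update k b α) (λ α β h → ign α β (λ i o → h i (outside-suc o))))
                     (ign (update k b α) α (λ i o → update-≢ k b α i (outside-≢ o)))

  assign-outside : ∀ {m} k (ρ : Fin m → Bool) α i → Outside k (k + m) i → assign k ρ α i ≡ α i
  assign-outside {zero} k ρ α i o = refl
  assign-outside {suc m} k ρ α i o =
    trans (assign-outside (suc k) (ρ ∘ suc) (update k (ρ zero) α) i (outside-suc o)) (update-≢ k (ρ zero) α i (outside-≢ o))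

  assign-inside : ∀ {m} k (ρ : Fin m → Bool) α i (j : Fin m) → toℕ i ≡ k + toℕ j → assign k ρ α i ≡ ρ j
  assign-inside {suc m} k ρ α i zero e =
    trans (assign-outside (suc k) (ρ ∘ suc) (update k (ρ zero) α) i (inj₁ (subst (_< suc k) (sym e') ≤-refl)))
          (update-≡ k (ρ zero) α i e')
    where
      e' : toℕ i ≡ k
      e' = trans e (+-identityʳ k)
  assign-inside {suc m} k ρ α i (suc j) e = assign-inside (suc k) (ρ ∘ suc) (update k (ρ zero) α) i j (trans e (+-suc k (toℕ j)))

-- Building circuits gate by gate

module CircuitBuilding (m : ℕ) where

  -- Gates are addressed by absolute position (0 = first gate), whereas a gate refers back to earlier
  -- gates by distance from the most recent one.
  gateAt : ∀ {k} → Gates m k → (Fin m → Bool) → ℕ → Bool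
  gateAt [] ρ i = false
  gateAt {suc k} (gs ▷ g) ρ i with i ≟ k
  ... | yes _ = evalGate g ρ (evalGates gs ρ)
  ... | no _ = gateAt gs ρ i

  gateAt-new : ∀ {k} (gs : Gates m k) g ρ → gateAt (gs ▷ g) ρ k ≡ evalGate g ρ (evalGates gs ρ)
  gateAt-new {k} gs g ρ with k ≟ k
  ... | yes _ = refl
  ... | no ne = ⊥-elim (ne refl)

  gateAt-old : ∀ {k} (gs : Gates m k) g ρ i → i < k → gateAt (gs ▷ g) ρ i ≡ gateAt gs ρ i
  gateAt-old {k} gs g ρ i lt with i ≟ k
  ... | yes e = ⊥-elim (<-irrefl e lt)
  ... | no _ = refl

  backRef : ∀ k i → i < k → Fin k
  backRef k i p = fromℕ< {k ∸ suc i} (∸-monoʳ-< {k} {suc i} (s≤s z≤n) p)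

  lookup-fromℕ< : ∀ {k} (vs : Vec Bool k) {r r'} .(p : r < k) .(p' : r' < k) → r ≡ r' →
                  lookup vs (fromℕ< p) ≡ lookup vs (fromℕ< p')
  lookup-fromℕ< vs p p' refl = refl

  lookup-backRef : ∀ {k} (gs : Gates m k) ρ i (p : i < k) → lookup (evalGates gs ρ) (backRef k i p) ≡ gateAt gs ρ i
  lookup-backRef {suc k} (gs ▷ g) ρ i p with i ≟ k
  ... | yes refl = lookup-fromℕ< (evalGates (gs ▷ g) ρ) _ (s≤s z≤n) (n∸n≡0 k)
  ... | no ne = trans (lookup-fromℕ< (evalGates (gs ▷ g) ρ) _ (s≤s (∸-monoʳ-< {k} {suc i} (s≤s z≤n) lt)) (+-∸-assoc 1 lt))
                      (lookup-backRef gs ρ i lt)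
    where
      lt : i < k
      lt = ≤∧≢⇒< (≤-pred p) ne

  record Extends {k k'} (gs : Gates m k) (gs' : Gates m k') : Set where
    constructor _,_
    field
      size-≤ : k ≤ k'
      keeps  : ∀ ρ i → i < k → gateAt gs' ρ i ≡ gateAt gs ρ i

  extends-refl : ∀ {k} (gs : Gates m k) → Extends gs gs
  extends-refl gs = ≤-refl , λ _ _ _ → refl

  extends-trans : ∀ {k k' k''} {gs : Gates m k} {gs' : Gates m k'} {gs'' : Gates m k''} →
                  Extends gs gs' → Extends gs' gs'' → Extends gs gs''
  extends-trans (a , f) (b , g) = ≤-trans a b , λ ρ i lt → trans (g ρ i (<-≤-trans lt a)) (f ρ i lt)

  Computes : ∀ {k} → Gates m k → ((Fin m → Bool) → Bool) → Set
  Computes {k} gs f = Σ ℕ λ i → (i < k) × (∀ ρ → gateAt gs ρ i ≡ f ρ)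

  computes-extends : ∀ {k k'} {gs : Gates m k} {gs' : Gates m k'} {f} → Extends gs gs' → Computes gs f → Computes gs' f
  computes-extends (le , e) (i , lt , v) = i , <-≤-trans lt le , λ ρ → trans (e ρ i lt) (v ρ)

  computes-cong : ∀ {k} {gs : Gates m k} {f g} → (∀ ρ → f ρ ≡ g ρ) → Computes gs f → Computes gs g
  computes-cong e (i , lt , v) = i , lt , λ ρ → trans (v ρ) (e ρ)

  record Grow {k} (gs : Gates m k) (c : ℕ) (P : ∀ {k'} → Gates m k' → Set) : Set where
    constructor mkGrow
    field
      k'      : ℕ
      gs'     : Gates m k'
      extends : Extends gs gs'
      bound   : k' ≤ k + c
      holds   : P gs'

  grow-weaken : ∀ {k} {gs : Gates m k} {c c'} {P : ∀ {k'} → Gates m k' → Set} → c ≤ c' → Grow gs c P → Grow gs c' P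
  grow-weaken {k} le (mkGrow k' gs' ext gr r) = mkGrow k' gs' ext (≤-trans gr (+-monoʳ-≤ k le)) r

  grow-map : ∀ {k} {gs : Gates m k} {c} {P Q : ∀ {k'} → Gates m k' → Set} →
             (∀ {k'} {gs' : Gates m k'} → Extends gs gs' → P gs' → Q gs') → Grow gs c P → Grow gs c Q
  grow-map f (mkGrow k' gs' ext gr r) = mkGrow k' gs' ext gr (f ext r)

  grow-return : ∀ {k} {gs : Gates m k} {P : ∀ {k'} → Gates m k' → Set} → P gs → Grow gs 0 P
  grow-return {k} {gs} p = mkGrow k gs (extends-refl gs) (≤-reflexive (sym (+-identityʳ k))) p

  grow-bind : ∀ {k} {gs : Gates m k} {c c'} {P Q : ∀ {k'} → Gates m k' → Set} →
              Grow gs c P → (∀ {k'} (gs' : Gates m k') → Extends gs gs' → P gs' → Grow gs' c' Q) → Grow gs (c + c') Q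
  grow-bind {k} {gs} {c} {c'} (mkGrow k₁ gs₁ ext₁ gr₁ r₁) f with f gs₁ ext₁ r₁
  ... | mkGrow k₂ gs₂ ext₂ gr₂ r₂ =
    mkGrow k₂ gs₂ (extends-trans ext₁ ext₂) (≤-trans gr₂ (≤-trans (+-monoˡ-≤ c' gr₁) (≤-reflexive (+-assoc k c c')))) r₂

  grow-cong : ∀ {k} {gs : Gates m k} {c f g} → (∀ ρ → f ρ ≡ g ρ) →
              Grow gs c (λ gs' → Computes gs' f) → Grow gs c (λ gs' → Computes gs' g)
  grow-cong e (mkGrow k' gs' ext gr r) = mkGrow k' gs' ext gr (computes-cong {gs = gs'} e r)

  grow-gate : ∀ {k} (gs : Gates m k) (g : Gate m k) → Grow gs 1 (λ gs' → Computes gs' (λ ρ → evalGate g ρ (evalGates gs ρ)))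
  grow-gate {k} gs g = mkGrow (suc k) (gs ▷ g) (n≤1+n k , gateAt-old gs g) (≤-reflexive (+-comm 1 k))
                         (k , ≤-refl , gateAt-new gs g)

  grow-input : ∀ {k} (gs : Gates m k) (j : Fin m) → Grow gs 1 (λ gs' → Computes gs' (λ ρ → ρ j))
  grow-input gs j = grow-gate gs (input j)

  grow-const : ∀ {k} (gs : Gates m k) (b : Bool) → Grow gs 1 (λ gs' → Computes gs' (λ ρ → b))
  grow-const gs b = grow-gate gs (const b)

  grow-not : ∀ {k} (gs : Gates m k) {f} → Computes gs f → Grow gs 1 (λ gs' → Computes gs' (λ ρ → not (f ρ)))
  grow-not {k} gs (i , lt , v) =
    grow-cong (λ ρ → cong not (trans (lookup-backRef gs ρ i lt) (v ρ)))
             (grow-gate gs (notG (backRef k i lt)))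

  grow-or : ∀ {k} (gs : Gates m k) {f g} → Computes gs f → Computes gs g → Grow gs 1 (λ gs' → Computes gs' (λ ρ → f ρ ∨ g ρ))
  grow-or {k} gs (i , lt , v) (j , lt' , v') =
    grow-cong (λ ρ → cong₂ _∨_ (trans (lookup-backRef gs ρ i lt) (v ρ)) (trans (lookup-backRef gs ρ j lt') (v' ρ)))
             (grow-gate gs (orG (backRef k i lt) (backRef k j lt')))

  grow-and : ∀ {k} (gs : Gates m k) {f g} → Computes gs f → Computes gs g → Grow gs 1 (λ gs' → Computes gs' (λ ρ → f ρ ∧ g ρ))
  grow-and {k} gs (i , lt , v) (j , lt' , v') =
    grow-cong (λ ρ → cong₂ _∧_ (trans (lookup-backRef gs ρ i lt) (v ρ)) (trans (lookup-backRef gs ρ j lt') (v' ρ)))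
             (grow-gate gs (andG (backRef k i lt) (backRef k j lt')))

  mux : Bool → Bool → Bool → Bool
  mux c t f = (c ∧ t) ∨ (not c ∧ f)

  mux-true : ∀ t f → mux true t f ≡ t
  mux-true t f = ∨-identityʳ t


  grow-mux : ∀ {k} (gs : Gates m k) {s t f} → Computes gs s → Computes gs t → Computes gs f →
             Grow gs 4 (λ gs' → Computes gs' (λ ρ → mux (s ρ) (t ρ) (f ρ)))
  grow-mux {k} gs {s} {t} {f} cs ct cf =
    grow-bind {c = 1} {c' = 3} {Q = Q} (grow-not gs cs) λ gs₁ e₁ cn →
    grow-bind {c = 1} {c' = 2} {Q = Q} (grow-and gs₁ (computes-extends e₁ cs) (computes-extends e₁ ct)) λ gs₂ e₂ ca →
    grow-bind {c = 1} {c' = 1} {Q = Q} (grow-and gs₂ (computes-extends e₂ cn) (computes-extends (extends-trans e₁ e₂) cf)) λ gs₃ e₃ cb →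
    grow-or gs₃ (computes-extends e₃ ca) cb
    where
      Q : ∀ {k'} → Gates m k' → Set
      Q gs' = Computes gs' (λ ρ → mux (s ρ) (t ρ) (f ρ))

m≤m*m : ∀ m → m ≤ m * m
m≤m*m zero = z≤n
m≤m*m (suc m) = m≤m+n (suc m) (m * suc m)

quadratic-bound : ∀ L p k → p ≤ L → k ≤ L * (p * 3 + 10) → suc k ≤ 13 * (L ^ 2) + 13
quadratic-bound L p k p≤L k≤ = begin
  suc k                         ≤⟨ s≤s k≤ ⟩
  suc (L * (p * 3 + 10))        ≤⟨ s≤s (*-monoʳ-≤ L (+-monoˡ-≤ 10 (*-monoˡ-≤ 3 p≤L))) ⟩
  suc (L * (L * 3 + 10))        ≡⟨ cong suc (expand L) ⟩
  suc (L * L * 3 + L * 10)      ≤⟨ s≤s (+-monoʳ-≤ (L * L * 3) (*-monoˡ-≤ 10 (m≤m*m L))) ⟩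
  suc (L * L * 3 + L * L * 10)  ≡⟨ cong suc (collect L) ⟩
  suc (13 * (L ^ 2))            ≤⟨ ≤-trans (≤-reflexive (+-comm 1 (13 * (L ^ 2)))) (+-monoʳ-≤ (13 * (L ^ 2)) (s≤s z≤n)) ⟩
  13 * (L ^ 2) + 13             ∎
  where
    open ≤-Reasoning

    expand : ∀ L → L * (L * 3 + 10) ≡ L * L * 3 + L * 10
    expand = solve-∀

    collect : ∀ L → L * L * 3 + L * L * 10 ≡ 13 * (L * (L * 1))
    collect = solve-∀

-- The interpolant

module Interpolation (np nq nr : ℕ) (qs : Vec Quant nq) (rs : Vec Quant nr)
                     (A : CNF (Fin np ⊎ Fin nq)) (B : CNF (Fin np ⊎ Fin nr))
                     (A-nonTaut : NonTautCNF A) (B-nonTaut : NonTautCNF B) where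

  F : QBF
  F = splitQBF np nq nr qs rs A B
  open QBF F
  open LQU F
  open Lines F

  eA : Fin np ⊎ Fin nq → Fin n
  eA = embA {np} {nq} {nr}

  eB : Fin np ⊎ Fin nr → Fin n
  eB = embB {np} {nq} {nr}

  MA : CNF (Fin n)
  MA = map (map (mapLit eA)) A

  MB : CNF (Fin n)
  MB = map (map (mapLit eB)) B

  toℕ-eA₁ : ∀ i → toℕ (eA (inj₁ i)) ≡ toℕ i
  toℕ-eA₁ i = toℕ-↑ˡ i (nq + nr)

  toℕ-eA₂ : ∀ j → toℕ (eA (inj₂ j)) ≡ np + toℕ j
  toℕ-eA₂ j = trans (toℕ-↑ʳ np (j ↑ˡ nr)) (cong (np +_) (toℕ-↑ˡ j nr))

  toℕ-eB₁ : ∀ i → toℕ (eB (inj₁ i)) ≡ toℕ i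
  toℕ-eB₁ i = toℕ-↑ˡ i (nq + nr)

  toℕ-eB₂ : ∀ j → toℕ (eB (inj₂ j)) ≡ np + (nq + toℕ j)
  toℕ-eB₂ j = trans (toℕ-↑ʳ np (nq ↑ʳ j)) (cong (np +_) (toℕ-↑ʳ nq j))

  p<np+ : ∀ (i : Fin np) c → toℕ i < np + c
  p<np+ i c = <-≤-trans (toℕ<n i) (m≤m+n np c)

  p≢np+ : ∀ (i : Fin np) c → toℕ i ≢ np + c
  p≢np+ i c e = <-irrefl e (p<np+ i c)

  eA-injective : ∀ {a b} → eA a ≡ eA b → a ≡ b
  eA-injective {inj₁ i} {inj₁ i'} eq = cong inj₁ (toℕ-injective (trans (sym (toℕ-eA₁ i)) (trans (cong toℕ eq) (toℕ-eA₁ i'))))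
  eA-injective {inj₁ i} {inj₂ j} eq = ⊥-elim (p≢np+ i _ (trans (sym (toℕ-eA₁ i)) (trans (cong toℕ eq) (toℕ-eA₂ j))))
  eA-injective {inj₂ j} {inj₁ i} eq = ⊥-elim (p≢np+ i _ (trans (sym (toℕ-eA₁ i)) (trans (cong toℕ (sym eq)) (toℕ-eA₂ j))))
  eA-injective {inj₂ j} {inj₂ j'} eq =
    cong inj₂ (toℕ-injective (+-cancelˡ-≡ np _ _ (trans (sym (toℕ-eA₂ j)) (trans (cong toℕ eq) (toℕ-eA₂ j')))))

  eB-injective : ∀ {a b} → eB a ≡ eB b → a ≡ b
  eB-injective {inj₁ i} {inj₁ i'} eq = cong inj₁ (toℕ-injective (trans (sym (toℕ-eB₁ i)) (trans (cong toℕ eq) (toℕ-eB₁ i'))))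
  eB-injective {inj₁ i} {inj₂ j} eq = ⊥-elim (p≢np+ i _ (trans (sym (toℕ-eB₁ i)) (trans (cong toℕ eq) (toℕ-eB₂ j))))
  eB-injective {inj₂ j} {inj₁ i} eq = ⊥-elim (p≢np+ i _ (trans (sym (toℕ-eB₁ i)) (trans (cong toℕ (sym eq)) (toℕ-eB₂ j))))
  eB-injective {inj₂ j} {inj₂ j'} eq =
    cong inj₂ (toℕ-injective (+-cancelˡ-≡ nq _ _ (+-cancelˡ-≡ np _ _ (trans (sym (toℕ-eB₂ j)) (trans (cong toℕ eq) (toℕ-eB₂ j'))))))

  MA-nonTaut : NonTautCNF MA
  MA-nonTaut = nonTaut-map eA eA-injective A A-nonTaut

  MB-nonTaut : NonTautCNF MB
  MB-nonTaut = nonTaut-map eB eB-injective B B-nonTaut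

  matrix-nonTaut : NonTautCNF matrix
  matrix-nonTaut C∈ with ∈-++⁻ MA C∈
  ... | inj₁ a = MA-nonTaut a
  ... | inj₂ b = MB-nonTaut b

  quantAt-replicate : ∀ a {b} (rest : Vec Quant b) k → k < a → quantAt (replicate a ∃Q ++ⱽ rest) k ≡ ∃Q
  quantAt-replicate (suc a) rest zero lt = refl
  quantAt-replicate (suc a) rest (suc k) (s≤s lt) = quantAt-replicate a rest k lt

  p-exist : ∀ i → ind i < np → IsExist i
  p-exist i lt = trans (quantAt-lookup prefix i) (quantAt-replicate np (qs ++ⱽ rs) (toℕ i) lt)

  univ⇒np≤ : ∀ u → IsUniv u → np ≤ ind u
  univ⇒np≤ u uu with ind u <? np
  ... | yes lt = ⊥-elim (univ-exist-⊥ u uu (p-exist u lt))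
  ... | no nlt = ≮⇒≥ nlt

  StarsUniversal : Clause → Set
  StarsUniversal E = ∀ {u} → star u ∈ E → IsUniv u

  module ResolutionFacts {E₁ E₂ R : Clause} (r : Resolution E₁ E₂ R)
                         (nt₁ : NonTaut E₁) (nt₂ : NonTaut E₂) (su₁ : StarsUniversal E₁) (su₂ : StarsUniversal E₂) where
    open Resolution r

    in₁ : ∀ {w} → w ∈ E₁ → w ∈ C₁ ⊎ (w ∈ U₁ ⊎ w ≡ lit (pos x))
    in₁ {w} w∈ with ∈-++⁻ C₁ (proj₁ (split₁ w) w∈)
    ... | inj₁ a = inj₁ a
    ... | inj₂ b with ∈-++⁻ U₁ b
    ...   | inj₁ u = inj₂ (inj₁ u)
    ...   | inj₂ (here e) = inj₂ (inj₂ e)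

    in₂ : ∀ {w} → w ∈ E₂ → w ∈ C₂ ⊎ (w ∈ U₂ ⊎ w ≡ lit (neg x))
    in₂ {w} w∈ with ∈-++⁻ C₂ (proj₁ (split₂ w) w∈)
    ... | inj₁ a = inj₁ a
    ... | inj₂ b with ∈-++⁻ U₂ b
    ...   | inj₁ u = inj₂ (inj₁ u)
    ...   | inj₂ (here e) = inj₂ (inj₂ e)

    C₁⊆E₁ : ∀ {w} → w ∈ C₁ → w ∈ E₁
    C₁⊆E₁ {w} a = proj₂ (split₁ w) (∈-++⁺ˡ a)

    C₂⊆E₂ : ∀ {w} → w ∈ C₂ → w ∈ E₂
    C₂⊆E₂ {w} a = proj₂ (split₂ w) (∈-++⁺ˡ a)

    C₁⊆R : ∀ {w} → w ∈ C₁ → w ∈ R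
    C₁⊆R {w} a = proj₂ (result w) (∈-++⁺ˡ a)

    C₂⊆R : ∀ {w} → w ∈ C₂ → w ∈ R
    C₂⊆R {w} b = proj₂ (result w) (∈-++⁺ʳ C₁ (∈-++⁺ˡ b))

    star-U₁⊆R : ∀ {w} → w ∈ U₁ → star (pvar w) ∈ R
    star-U₁⊆R u = proj₂ (result _) (∈-++⁺ʳ C₁ (∈-++⁺ʳ C₂ (∈-map⁺ (star ∘ pvar) u)))

    U₂→U₁ : ∀ {w} → w ∈ U₂ → Σ PLit λ w' → w' ∈ U₁ × pvar w ≡ pvar w'
    U₂→U₁ {w} u = ∈-map⁻ pvar (proj₂ (sameVar (pvar w)) (∈-map⁺ pvar u))

    U₁-right : ∀ {w} → w ∈ U₁ → UnivRightOf x w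
    U₁-right u = U₁univ u , below u

    U₂-right : ∀ {w} → w ∈ U₂ → UnivRightOf x w
    U₂-right u with U₂→U₁ u
    ... | w' , w'∈ , e = U₂univ u , subst (λ z → ind x < ind z) (sym e) (below w'∈)

    survives₁ : ∀ {w} → w ∈ E₁ → w ≢ lit (pos x) → SurvivesIn x w R
    survives₁ w∈ ne with in₁ w∈
    ... | inj₁ a = inj₁ (C₁⊆R a)
    ... | inj₂ (inj₁ u) = inj₂ (U₁-right u , star-U₁⊆R u)
    ... | inj₂ (inj₂ e) = ⊥-elim (ne e)

    survives₂ : ∀ {w} → w ∈ E₂ → w ≢ lit (neg x) → SurvivesIn x w R
    survives₂ w∈ ne with in₂ w∈
    ... | inj₁ a = inj₁ (C₂⊆R a)
    ... | inj₂ (inj₂ e) = ⊥-elim (ne e)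
    ... | inj₂ (inj₁ u) with U₂→U₁ u
    ...   | w' , w'∈ , e = inj₂ (U₂-right u , subst (_∈ R) (cong star (sym e)) (star-U₁⊆R w'∈))

    clash : ∀ {w₁ w₂} → w₁ ∈ E₁ → w₂ ∈ E₂ → w₁ ≢ lit (pos x) → w₂ ≢ lit (neg x) →
            pvar w₁ ≡ pvar w₂ → ¬ UnivRightOf x w₁ → (w₁ ≡ w₂) × ¬ IsStar w₁
    clash a b n₁ n₂ eq nub with in₁ a | in₂ b
    ... | inj₂ (inj₂ e) | _ = ⊥-elim (n₁ e)
    ... | _ | inj₂ (inj₂ e) = ⊥-elim (n₂ e)
    ... | inj₂ (inj₁ u) | _ = ⊥-elim (nub (U₁-right u))
    ... | inj₁ _ | inj₂ (inj₁ u) = ⊥-elim (nub (subst (λ v → IsUniv v × ind x < ind v) (sym eq) (U₂-right u)))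
    ... | inj₁ c₁ | inj₁ c₂ = noClash c₁ c₂ eq

    relaxed : RelaxedRes x E₁ E₂ R
    relaxed = record
      { pos∈ = proj₂ (split₁ _) (∈-++⁺ʳ C₁ (∈-++⁺ʳ U₁ (here refl)))
      ; neg∈ = proj₂ (split₂ _) (∈-++⁺ʳ C₂ (∈-++⁺ʳ U₂ (here refl)))
      ; survives₁ = survives₁ ; survives₂ = survives₂ ; clash = clash }

    R-parts : ∀ {w} → w ∈ R → w ∈ C₁ ⊎ (w ∈ C₂ ⊎ Σ PLit λ w' → w' ∈ U₁ × w ≡ star (pvar w'))
    R-parts {w} w∈ with ∈-++⁻ C₁ (proj₁ (result w) w∈)
    ... | inj₁ a = inj₁ a
    ... | inj₂ b with ∈-++⁻ C₂ b
    ...   | inj₁ c = inj₂ (inj₁ c)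
    ...   | inj₂ d with ∈-map⁻ (star ∘ pvar) d
    ...     | w' , w'∈ , e = inj₂ (inj₂ (w' , w'∈ , e))

    R-nonTaut : NonTaut R
    R-nonTaut l a b with R-parts a | R-parts b
    ... | inj₂ (inj₂ (_ , _ , ())) | _
    ... | _ | inj₂ (inj₂ (_ , _ , ()))
    ... | inj₁ a' | inj₁ b' = nt₁ l (C₁⊆E₁ a') (C₁⊆E₁ b')
    ... | inj₂ (inj₁ a') | inj₂ (inj₁ b') = nt₂ l (C₂⊆E₂ a') (C₂⊆E₂ b')
    ... | inj₁ a' | inj₂ (inj₁ b') = compl-≢ l (lit-injective (proj₁ (noClash a' b' (sym (var-compl l)))))
    ... | inj₂ (inj₁ a') | inj₁ b' = compl-≢ l (sym (lit-injective (proj₁ (noClash b' a' (var-compl l)))))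

    R-starsUniversal : StarsUniversal R
    R-starsUniversal a with R-parts a
    ... | inj₁ a' = su₁ (C₁⊆E₁ a')
    ... | inj₂ (inj₁ b') = su₂ (C₂⊆E₂ b')
    ... | inj₂ (inj₂ (w' , w'∈ , refl)) = U₁univ w'∈

  module ReductionFacts {E D : Clause} (fr : ForallRed E D) where
    open ForallRed fr

    inE : ∀ {v} → v ∈ E → v ∈ D ⊎ v ≡ w
    inE {v} v∈ with ∈-++⁻ D (proj₁ (split v) v∈)
    ... | inj₁ a = inj₁ a
    ... | inj₂ (here e) = inj₂ e

    D⊆E : ∀ {v} → v ∈ D → v ∈ E
    D⊆E {v} a = proj₂ (split v) (∈-++⁺ˡ a)

    pvar-w : pvar w ≡ var u
    pvar-w with w-form
    ... | inj₁ refl = refl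
    ... | inj₂ refl = refl

  module SideDerivations (M : CNF (Fin n)) (M-nonTaut : NonTautCNF M) (Side : Fin n → Set) where
    open Restricted F M M-nonTaut

    OnSide : Clause → Set
    OnSide L = ∀ {w} → w ∈ L → Side (pvar w)

    SideDer : (Fin n → Bool) → Clause → Set
    SideDer β L = Der np β L × OnSide L

    Subsumed : (Fin n → Bool) → Clause → Set
    Subsumed β E = Σ Clause λ L → SideDer β L × L ⊆⋆ E

    subsumed-ax : ∀ {β C} → C ∈ M → (∀ {l} → l ∈ C → ind (var l) < np → evalLit β l ≡ false) →
                  (∀ {l} → l ∈ C → np ≤ ind (var l) → Side (var l)) → Subsumed β (map lit C)
    subsumed-ax {β} {C} C∈ hf hq = L' , (ax C∈ hf hin nt' sc' , onSide) , sub'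
      where
        unassigned? : (l : Lit (Fin n)) → Dec (np ≤ ind (var l))
        unassigned? l = np ≤? ind (var l)

        L' : Clause
        L' = map lit (filter unassigned? C)

        C-part : ∀ {w} → w ∈ L' → Σ (Lit (Fin n)) λ l → w ≡ lit l × l ∈ C × np ≤ ind (var l)
        C-part w∈ with ∈-map⁻ lit w∈
        ... | l , l∈ , refl with ∈-filter⁻ unassigned? {xs = C} l∈
        ...   | l∈C , le = l , refl , l∈C , le

        hin : ∀ {l} → l ∈ C → np ≤ ind (var l) → lit l ∈ L'
        hin l∈ le = ∈-map⁺ lit (∈-filter⁺ unassigned? l∈ le)

        nt' : NonTaut L'
        nt' l a b with C-part a | C-part b
        ... | _ , refl , a' , _ | _ , refl , b' , _ = nonTaut-compl M-nonTaut C∈ l a' b'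

        sc' : Scoped np L'
        sc' w∈ with C-part w∈
        ... | _ , refl , _ , le = le

        sub' : L' ⊆⋆ map lit C
        sub' w∈ with C-part w∈
        ... | _ , refl , l∈ , _ = inj₁ (∈-map⁺ lit l∈)

        onSide : OnSide L'
        onSide w∈ with C-part w∈
        ... | _ , refl , l∈ , le = hq l∈ le

    subsumed-red : ∀ {β E D} → ForallRed E D → StarsUniversal E → Subsumed β E → Subsumed β D
    subsumed-red {β} {E} {D} fr su (L , (d , onSide) , sub) =
      L' , (red d (var u) univ (univ⇒np≤ (var u) univ) ord cov nt' sc' , onSide ∘ proj₁ ∘ ∈-filter⁻ notU?) , sub'
      where
        open ForallRed fr
        open ReductionFacts fr

        notU? : (v : PLit) → Dec (pvar v ≢ var u)
        notU? v = ¬? (pvar v Fin.≟ var u)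

        L' : Clause
        L' = filter notU? L

        ord-D : ∀ v → v ∈ D → InScope np v → IsExist (pvar v) → ind (pvar v) ≤ ind (var u)
        ord-D (lit l) v∈ _ ie = order l v∈ ie
        ord-D (star x) v∈ (_ , un) ie = ⊥-elim (univ-exist-⊥ x un ie)

        ord : ∀ {v} → v ∈ L → IsExist (pvar v) → ind (pvar v) ≤ ind (var u)
        ord {v} v∈ ie with sub v∈
        ... | inj₂ (l , refl , s∈) = ⊥-elim (univ-exist-⊥ (var l) (su s∈) ie)
        ... | inj₁ v∈E with inE v∈E
        ...   | inj₁ v∈D = ord-D v v∈D (der-scoped d v∈) ie
        ...   | inj₂ refl = ⊥-elim (univ-exist-⊥ (pvar w) (subst IsUniv (sym pvar-w) univ) ie)

        cov : ∀ {v} → v ∈ L → pvar v ≡ var u ⊎ v ∈⋆ L'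
        cov {v} v∈ with pvar v Fin.≟ var u
        ... | yes e = inj₁ e
        ... | no n' = inj₂ (inj₁ (∈-filter⁺ notU? v∈ n'))

        nt' : NonTaut L'
        nt' l a b = der-nonTaut d l (proj₁ (∈-filter⁻ notU? a)) (proj₁ (∈-filter⁻ notU? b))

        sc' : Scoped np L'
        sc' a = der-scoped d (proj₁ (∈-filter⁻ notU? a))

        sub' : L' ⊆⋆ D
        sub' a with ∈-filter⁻ notU? a
        ... | a' , n' with sub a'
        ...   | inj₁ v∈E with inE v∈E
        ...     | inj₁ v∈D = inj₁ v∈D
        ...     | inj₂ refl = ⊥-elim (n' pvar-w)
        sub' a | a' , n' | inj₂ (l , refl , s∈) with inE s∈
        ...     | inj₁ s∈D = inj₂ (l , refl , s∈D)
        ...     | inj₂ e = ⊥-elim (n' (trans (cong pvar e) pvar-w))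

    subsumed-res : ∀ {β E₁ E₂ R} (r : Resolution E₁ E₂ R) → NonTaut E₁ → NonTaut E₂ →
                   StarsUniversal E₁ → StarsUniversal E₂ → np ≤ ind (Resolution.x r) →
                   Subsumed β E₁ → Subsumed β E₂ → Subsumed β R
    subsumed-res r nt₁ nt₂ su₁ su₂ le (L₁ , (d₁ , v₁) , s₁) (L₂ , (d₂ , v₂) , s₂)
      with resolve-⊆⋆ RF.relaxed RF.R-nonTaut le d₁ d₂ s₁ s₂
      where module RF = ResolutionFacts r nt₁ nt₂ su₁ su₂
    ... | L' , d' , sub , draws = L' , (d' , onSide) , sub
      where
        onSide : OnSide L'
        onSide w∈ with draws w∈
        ... | w₀ , inj₁ a , e = subst Side (sym e) (v₁ a)
        ... | w₀ , inj₂ b , e = subst Side (sym e) (v₂ b)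

    sideDer-np≤ : ∀ {β L w} → SideDer β L → w ∈ L → np ≤ ind (pvar w)
    sideDer-np≤ {w = w} (d , _) w∈ = inScope⇒≤ w (der-scoped d w∈)

  InA : Fin n → Set
  InA v = ind v < np + nq

  InB : Fin n → Set
  InB v = np + nq ≤ ind v

  module SA = SideDerivations MA MA-nonTaut InA
  module SB = SideDerivations MB MB-nonTaut InB

  pAssign : (Fin np → Bool) → Fin n → Bool
  pAssign a i with toℕ i <? np
  ... | yes p = a (fromℕ< p)
  ... | no _ = false

  pAssign-< : ∀ a i (p : toℕ i < np) → pAssign a i ≡ a (fromℕ< p)
  pAssign-< a i p with toℕ i <? np
  ... | yes _ = refl
  ... | no q = ⊥-elim (q p)

  pAssign-p : ∀ a (i : Fin np) → pAssign a (i ↑ˡ (nq + nr)) ≡ a i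
  pAssign-p a i = trans (pAssign-< a _ lt) (cong a (toℕ-injective (trans (toℕ-fromℕ< lt) (toℕ-↑ˡ i (nq + nr)))))
    where
      lt = subst (_< np) (sym (toℕ-↑ˡ i (nq + nr))) (toℕ<n i)

  module LE = LevelEvaluation prefix

  quantAt-++ʳ : ∀ {a b} (xs : Vec Quant a) (ys : Vec Quant b) k → quantAt (xs ++ⱽ ys) (a + k) ≡ quantAt ys k
  quantAt-++ʳ [] ys k = refl
  quantAt-++ʳ (x ∷ xs) ys k = quantAt-++ʳ xs ys k

  quantAt-++ˡ : ∀ {a b} (xs : Vec Quant a) (ys : Vec Quant b) k → k < a → quantAt (xs ++ⱽ ys) k ≡ quantAt xs k
  quantAt-++ˡ (x ∷ xs) ys zero _ = refl
  quantAt-++ˡ (x ∷ xs) ys (suc k) (s≤s lt) = quantAt-++ˡ xs ys k lt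

  quantsAt-from : ∀ {m} (qs' : Vec Quant m) k → (∀ i → i < m → quantAt prefix (k + i) ≡ quantAt qs' i) → LE.QuantsAt k qs'
  quantsAt-from [] k h = tt
  quantsAt-from (Q ∷ qs') k h =
    subst (λ z → quantAt prefix z ≡ Q) (+-identityʳ k) (h 0 (s≤s z≤n)) ,
    quantsAt-from qs' (suc k) (λ i lt → subst (λ z → quantAt prefix z ≡ quantAt qs' i) (+-suc k i) (h (suc i) (s≤s lt)))

  quantsAt-q : LE.QuantsAt np qs
  quantsAt-q = quantsAt-from qs np (λ i lt → trans (quantAt-++ʳ (replicate np ∃Q) (qs ++ⱽ rs) i) (quantAt-++ˡ qs rs i lt))

  quantsAt-r : LE.QuantsAt (nq + np) rs
  quantsAt-r = quantsAt-from rs (nq + np) (λ i lt →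
    trans (cong (quantAt prefix) (trans (cong (_+ i) (+-comm nq np)) (+-assoc np nq i)))
          (trans (quantAt-++ʳ (replicate np ∃Q) (qs ++ⱽ rs) (nq + i)) (quantAt-++ʳ qs rs i)))

  evalMA : (Fin n → Bool) → Bool
  evalMA β = evalCNF β MA

  evalMB : (Fin n → Bool) → Bool
  evalMB β = evalCNF β MB

  eA-< : ∀ v → toℕ (eA v) < np + nq
  eA-< (inj₁ i) = subst (_< np + nq) (sym (toℕ-eA₁ i)) (p<np+ i nq)
  eA-< (inj₂ j) = subst (_< np + nq) (sym (toℕ-eA₂ j)) (+-monoʳ-< np (toℕ<n j))

  eB-outside : ∀ v → LE.Outside np (np + nq) (eB v)
  eB-outside (inj₁ i) = inj₁ (subst (_< np) (sym (toℕ-eB₁ i)) (toℕ<n i))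
  eB-outside (inj₂ j) = inj₂ (subst (np + nq ≤_) (sym (toℕ-eB₂ j)) (+-monoʳ-≤ np (m≤m+n nq (toℕ j))))

  evalMA-ignores-r : LE.Ignores (nq + np) (nq + np + nr) evalMA
  evalMA-ignores-r β β' h = trans (evalCNF-map eA β A) (trans (evalCNF-cong
    (λ v → h (eA v) (inj₁ (subst (toℕ (eA v) <_) (+-comm np nq) (eA-< v)))) A) (sym (evalCNF-map eA β' A)))

  evalMB-ignores-q : LE.Ignores np (np + nq) evalMB
  evalMB-ignores-q β β' h = trans (evalCNF-map eB β B) (trans (evalCNF-cong
    (λ v → h (eB v) (eB-outside v)) B) (sym (evalCNF-map eB β' B)))

  evalLevels-MA : ∀ a → evalLevels prefix (nq + nr) np evalMA (pAssign a) ≡ evalQ qs (λ ρ → evalCNF [ a , ρ ] A)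
  evalLevels-MA a =
    trans (LE.evalLevels-+ nq nr np evalMA (pAssign a))
   (trans (LE.evalLevels-evalQ qs np (evalLevels prefix nr (nq + np) evalMA) (pAssign a) quantsAt-q)
          (evalQ-cong qs λ ρ → trans (LE.evalLevels-ignored nr (nq + np) evalMA _ evalMA-ignores-r)
             (trans (evalCNF-map eA (LE.assign np ρ (pAssign a)) A) (evalCNF-cong (agrees ρ) A))))
    where
      agrees : ∀ ρ v → LE.assign np ρ (pAssign a) (eA v) ≡ [ a , ρ ] v
      agrees ρ (inj₁ i) = trans (LE.assign-outside np ρ (pAssign a) (eA (inj₁ i))
                                  (inj₁ (subst (_< np) (sym (toℕ-eA₁ i)) (toℕ<n i)))) (pAssign-p a i)
      agrees ρ (inj₂ j) = LE.assign-inside np ρ (pAssign a) (eA (inj₂ j)) j (toℕ-eA₂ j)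

  evalLevels-MB : ∀ a → evalLevels prefix (nq + nr) np evalMB (pAssign a) ≡ evalQ rs (λ ρ → evalCNF [ a , ρ ] B)
  evalLevels-MB a =
    trans (LE.evalLevels-+ nq nr np evalMB (pAssign a))
   (trans (LE.evalLevels-ignored nq np (evalLevels prefix nr (nq + np) evalMB) (pAssign a)
             (LE.evalLevels-ignores nr (nq + np) evalMB evalMB-ignores-q (≤-reflexive (+-comm np nq))))
   (trans (LE.evalLevels-evalQ rs (nq + np) evalMB (pAssign a) quantsAt-r)
          (evalQ-cong rs λ ρ → trans (evalCNF-map eB (LE.assign (nq + np) ρ (pAssign a)) B) (evalCNF-cong (agrees ρ) B))))
    where
      agrees : ∀ ρ v → LE.assign (nq + np) ρ (pAssign a) (eB v) ≡ [ a , ρ ] v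
      agrees ρ (inj₁ i) = trans (LE.assign-outside (nq + np) ρ (pAssign a) (eB (inj₁ i))
                                  (inj₁ (subst (_< nq + np) (sym (toℕ-eB₁ i)) (<-≤-trans (toℕ<n i) (m≤n+m np nq))))) (pAssign-p a i)
      agrees ρ (inj₂ j) = LE.assign-inside (nq + np) ρ (pAssign a) (eB (inj₂ j)) j
                            (trans (toℕ-eB₂ j) (trans (sym (+-assoc np nq (toℕ j))) (cong (_+ toℕ j) (+-comm np nq))))

  pivots : ∀ {Γ} → Derivation Γ → List (Fin n)
  pivots [] = []
  pivots (d ▷ axiom _) = pivots d
  pivots (d ▷ red _ _) = pivots d
  pivots (d ▷ res _ _ r) = Resolution.x r ∷ pivots d

  length-snoc : ∀ (Γ : List Clause) C → length (Γ ++ (C ∷ [])) ≡ suc (length Γ)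
  length-snoc Γ C = trans (length-++ Γ) (+-comm (length Γ) 1)

  pivots-length : ∀ {Γ} (d : Derivation Γ) → length (pivots d) ≤ length Γ
  pivots-length [] = z≤n
  pivots-length (_▷_ {Γ} {C} d (axiom _)) = subst (length (pivots d) ≤_) (sym (length-snoc Γ C)) (m≤n⇒m≤1+n (pivots-length d))
  pivots-length (_▷_ {Γ} {C} d (red _ _)) = subst (length (pivots d) ≤_) (sym (length-snoc Γ C)) (m≤n⇒m≤1+n (pivots-length d))
  pivots-length (_▷_ {Γ} {C} d (res _ _ r)) = subst (suc (length (pivots d)) ≤_) (sym (length-snoc Γ C)) (s≤s (pivots-length d))

  module WithPivots (P : List (Fin n)) where

    TrueP : (Fin np → Bool) → Clause → Set
    TrueP a E = Σ (Lit (Fin n)) λ l → lit l ∈ E × ind (var l) < np × evalLit (pAssign a) l ≡ true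

    UnresolvedP : Clause → Set
    UnresolvedP E = Σ (Lit (Fin n)) λ l → lit l ∈ E × ind (var l) < np × var l ∉ P

    SideDer : Bool → (Fin np → Bool) → Clause → Set
    SideDer false a = SA.SideDer (pAssign a)
    SideDer true a = SB.SideDer (pAssign a)

    Subsumed : Bool → (Fin np → Bool) → Clause → Set
    Subsumed s a E = Σ Clause λ L → SideDer s a L × L ⊆⋆ E

    -- The invariant of a line E under the values t, s of its two gates: t = true exhibits a p-literal of E
    -- made true by a; otherwise E keeps a p-literal that is never resolved (so cannot be the empty clause)
    -- or E is subsumed by a restricted derivation from the A-side (s = false) or the B-side (s = true).
    record Claim (a : Fin np → Bool) (E : Clause) (t s : Bool) : Set where
      constructor claim
      field
        ifTrue  : t ≡ true → TrueP a E
        ifFalse : t ≡ false → UnresolvedP E ⊎ Subsumed s a E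

    claim-map : ∀ {a E R t s} →
      (∀ {l} → lit l ∈ E → ind (var l) < np → evalLit (pAssign a) l ≡ true → lit l ∈ R) →
      (∀ {l} → lit l ∈ E → ind (var l) < np → var l ∉ P → lit l ∈ R) →
      (Subsumed s a E → Subsumed s a R) → Claim a E t s → Claim a R t s
    claim-map {a} {E} {R} keepTrue keepUnresolved keepSubsumed (claim h₁ h₂) =
      claim (λ e → trueP (h₁ e)) (λ e → Sum.map unresolvedP keepSubsumed (h₂ e))
      where
        trueP : TrueP a E → TrueP a R
        trueP (l , l∈ , lt , ev) = l , keepTrue l∈ lt ev , lt , ev

        unresolvedP : UnresolvedP E → UnresolvedP R
        unresolvedP (l , l∈ , lt , nP) = l , keepUnresolved l∈ lt nP , lt , nP

    sideDer-np≤ : ∀ s {a L w} → SideDer s a L → w ∈ L → np ≤ ind (pvar w)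
    sideDer-np≤ false = SA.sideDer-np≤
    sideDer-np≤ true = SB.sideDer-np≤

    subsumed-red : ∀ s {a E D} → ForallRed E D → StarsUniversal E → Subsumed s a E → Subsumed s a D
    subsumed-red false = SA.subsumed-red
    subsumed-red true = SB.subsumed-red

    claim-red : ∀ {a E D t} s → ForallRed E D → StarsUniversal E → Claim a E t s → Claim a D t s
    claim-red {E = E} {D} s fr su = claim-map (λ l∈ lt _ → keep l∈ lt) (λ l∈ lt _ → keep l∈ lt) (subsumed-red s fr su)
      where
        open ForallRed fr
        open ReductionFacts fr

        keep : ∀ {l} → lit l ∈ E → ind (var l) < np → lit l ∈ D
        keep {l} l∈ lt with inE l∈
        ... | inj₁ l∈D = l∈D
        ... | inj₂ e = ⊥-elim (univ-exist-⊥ (var l) (subst IsUniv (sym (trans (cong pvar e) pvar-w)) univ) (p-exist (var l) lt))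

    trueLit-≢ : ∀ {a l} p → evalLit (pAssign a) p ≡ false → evalLit (pAssign a) l ≡ true → l ≢ p
    trueLit-≢ p f t refl with trans (sym t) f
    ... | ()

    unresolved-≢ : ∀ {l} p → var p ∈ P → var l ∉ P → l ≢ p
    unresolved-≢ p p∈ l∉ refl = l∉ p∈

    module ResolutionClaims {E₁ E₂ R : Clause} (r : Resolution E₁ E₂ R) (nt₁ : NonTaut E₁) (nt₂ : NonTaut E₂)
                            (su₁ : StarsUniversal E₁) (su₂ : StarsUniversal E₂) where
      module RF = ResolutionFacts r nt₁ nt₂ su₁ su₂
      x = Resolution.x r

      keep₁ : ∀ {l} → lit l ∈ E₁ → ind (var l) < np → l ≢ pos x → lit l ∈ R
      keep₁ {l} l∈ lt ne with RF.survives₁ l∈ (ne ∘ lit-injective)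
      ... | inj₁ i = i
      ... | inj₂ ((un , _) , _) = ⊥-elim (univ-exist-⊥ (var l) un (p-exist (var l) lt))

      keep₂ : ∀ {l} → lit l ∈ E₂ → ind (var l) < np → l ≢ neg x → lit l ∈ R
      keep₂ {l} l∈ lt ne with RF.survives₂ l∈ (ne ∘ lit-injective)
      ... | inj₁ i = i
      ... | inj₂ ((un , _) , _) = ⊥-elim (univ-exist-⊥ (var l) un (p-exist (var l) lt))

      ⊆⋆-R₁ : ∀ {L} → L ⊆⋆ E₁ → (∀ {w} → w ∈ L → pvar w ≢ x) → L ⊆⋆ R
      ⊆⋆-R₁ sub nx w∈ = ∈⋆-survives RF.survives₁ (sub w∈) (λ e → nx w∈ (cong pvar e))

      ⊆⋆-R₂ : ∀ {L} → L ⊆⋆ E₂ → (∀ {w} → w ∈ L → pvar w ≢ x) → L ⊆⋆ R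
      ⊆⋆-R₂ sub nx w∈ = ∈⋆-survives RF.survives₂ (sub w∈) (λ e → nx w∈ (cong pvar e))

      -- Resolution on a p-variable: a(x) decides which premise is falsified, and that premise's claim carries over.
      module PivotP (xp : ind x < np) (x∈P : x ∈ P) where
        avoidsPivot : ∀ s {a L w} → SideDer s a L → w ∈ L → pvar w ≢ x
        avoidsPivot s dd w∈ e = <-irrefl refl (<-≤-trans xp (subst (λ z → np ≤ ind z) e (sideDer-np≤ s dd w∈)))

        claim-true : ∀ {a t} s → pAssign a x ≡ true → Claim a E₂ t s → Claim a R t s
        claim-true s ax = claim-map
          (λ l∈ lt ev → keep₂ l∈ lt (trueLit-≢ (neg x) (cong not ax) ev))
          (λ l∈ lt nP → keep₂ l∈ lt (unresolved-≢ (neg x) x∈P nP))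
          (λ { (L , dd , sub) → L , dd , ⊆⋆-R₂ sub (avoidsPivot s dd) })

        claim-false : ∀ {a t} s → pAssign a x ≡ false → Claim a E₁ t s → Claim a R t s
        claim-false s ax = claim-map
          (λ l∈ lt ev → keep₁ l∈ lt (trueLit-≢ (pos x) ax ev))
          (λ l∈ lt nP → keep₁ l∈ lt (unresolved-≢ (pos x) x∈P nP))
          (λ { (L , dd , sub) → L , dd , ⊆⋆-R₁ sub (avoidsPivot s dd) })

      -- Resolution on a q- or r-variable: a side derivation that cannot contain x already subsumes R;
      -- otherwise both premises are subsumed from the side of x and their derivations are resolved.
      module PivotQR (np≤x : np ≤ ind x) where
        p≢x : ∀ {y} → ind y < np → y ≢ x
        p≢x lt refl = <-irrefl refl (<-≤-trans lt np≤x)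

        keepP₁ : ∀ {l} → lit l ∈ E₁ → ind (var l) < np → lit l ∈ R
        keepP₁ l∈ lt = keep₁ l∈ lt (p≢x lt ∘ cong var)

        keepP₂ : ∀ {l} → lit l ∈ E₂ → ind (var l) < np → lit l ∈ R
        keepP₂ l∈ lt = keep₂ l∈ lt (p≢x lt ∘ cong var)

        claim-res : ∀ {a} t₁ t₂ s₁ s₂ s → Claim a E₁ t₁ s₁ → Claim a E₂ t₂ s₂ →
                    (Subsumed s₁ a E₁ → Subsumed s₂ a E₂ → Subsumed s a R) → Claim a R (t₁ ∨ t₂) s
        claim-res true t₂ s₁ s₂ s (claim h₁ _) _ _ with h₁ refl
        ... | l , l∈ , lt , ev = claim (λ _ → l , keepP₁ l∈ lt , lt , ev) λ ()
        claim-res false true s₁ s₂ s _ (claim h₁ _) _ with h₁ refl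
        ... | l , l∈ , lt , ev = claim (λ _ → l , keepP₂ l∈ lt , lt , ev) λ ()
        claim-res {a} false false s₁ s₂ s (claim _ h₁) (claim _ h₂) combine-sides = claim (λ ()) λ _ → both (h₁ refl) (h₂ refl)
          where
            both : UnresolvedP E₁ ⊎ Subsumed s₁ a E₁ → UnresolvedP E₂ ⊎ Subsumed s₂ a E₂ → UnresolvedP R ⊎ Subsumed s a R
            both (inj₁ (l , l∈ , lt , nP)) _ = inj₁ (l , keepP₁ l∈ lt , lt , nP)
            both (inj₂ _) (inj₁ (l , l∈ , lt , nP)) = inj₁ (l , keepP₂ l∈ lt , lt , nP)
            both (inj₂ S₁) (inj₂ S₂) = inj₂ (combine-sides S₁ S₂)

        subsumed-q : ∀ {a} s₁ s₂ → ind x < np + nq → Subsumed s₁ a E₁ → Subsumed s₂ a E₂ → Subsumed (s₁ ∨ s₂) a R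
        subsumed-q true s₂ xq (L , dd , sub) _ = L , dd , ⊆⋆-R₁ sub (avoids dd)
          where
            avoids : ∀ {a L} → SideDer true a L → ∀ {w} → w ∈ L → pvar w ≢ x
            avoids (_ , onB) w∈ e = <-irrefl refl (<-≤-trans xq (subst (λ z → np + nq ≤ ind z) e (onB w∈)))
        subsumed-q false true xq _ (L , dd , sub) = L , dd , ⊆⋆-R₂ sub (avoids dd)
          where
            avoids : ∀ {a L} → SideDer true a L → ∀ {w} → w ∈ L → pvar w ≢ x
            avoids (_ , onB) w∈ e = <-irrefl refl (<-≤-trans xq (subst (λ z → np + nq ≤ ind z) e (onB w∈)))
        subsumed-q false false xq S₁ S₂ = SA.subsumed-res r nt₁ nt₂ su₁ su₂ np≤x S₁ S₂

        subsumed-r : ∀ {a} s₁ s₂ → np + nq ≤ ind x → Subsumed s₁ a E₁ → Subsumed s₂ a E₂ → Subsumed (s₁ ∧ s₂) a R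
        subsumed-r false s₂ xr (L , dd , sub) _ = L , dd , ⊆⋆-R₁ sub (avoids dd)
          where
            avoids : ∀ {a L} → SideDer false a L → ∀ {w} → w ∈ L → pvar w ≢ x
            avoids (_ , onA) w∈ e = <-irrefl refl (<-≤-trans (subst (λ z → ind z < np + nq) e (onA w∈)) xr)
        subsumed-r true false xr _ (L , dd , sub) = L , dd , ⊆⋆-R₂ sub (avoids dd)
          where
            avoids : ∀ {a L} → SideDer false a L → ∀ {w} → w ∈ L → pvar w ≢ x
            avoids (_ , onA) w∈ e = <-irrefl refl (<-≤-trans (subst (λ z → ind z < np + nq) e (onA w∈)) xr)
        subsumed-r true true xr S₁ S₂ = SB.subsumed-res r nt₁ nt₂ su₁ su₂ np≤x S₁ S₂

    open import Data.List.Membership.DecPropositional (Lit-≟ {n}) using () renaming (_∈?_ to _∈ᴸ?_)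
    open import Data.List.Membership.DecPropositional (Fin._≟_ {n}) using () renaming (_∈?_ to _∈ᶠ?_)

    litValue : (Fin np → Bool) → List (Lit (Fin n)) → Fin n → Bool
    litValue a C v with pos v ∈ᴸ? C
    ... | yes _ = pAssign a v
    ... | no _ with neg v ∈ᴸ? C
    ...   | yes _ = not (pAssign a v)
    ...   | no _ = false

    pLitValue : (Fin np → Bool) → List (Lit (Fin n)) → Fin n → Bool
    pLitValue a C v with toℕ v <? np
    ... | yes _ = litValue a C v
    ... | no _ = false

    false≢true : false ≢ true
    false≢true ()

    litValue-true : ∀ a C v → litValue a C v ≡ true → Σ (Lit (Fin n)) λ l → l ∈ C × var l ≡ v × evalLit (pAssign a) l ≡ true
    litValue-true a C v e with pos v ∈ᴸ? C
    ... | yes q = pos v , q , refl , e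
    ... | no _ with neg v ∈ᴸ? C
    ...   | yes q = neg v , q , refl , e
    ...   | no _ = ⊥-elim (false≢true e)

    litValue-false : ∀ a C l → l ∈ C → (∀ l → l ∈ C → compl l ∈ C → ⊥) →
                     litValue a C (var l) ≡ false → evalLit (pAssign a) l ≡ false
    litValue-false a C (pos v) l∈ ntc e with pos v ∈ᴸ? C
    ... | yes _ = e
    ... | no p∉ = ⊥-elim (p∉ l∈)
    litValue-false a C (neg v) l∈ ntc e with pos v ∈ᴸ? C
    ... | yes p∈ = ⊥-elim (ntc (pos v) p∈ l∈)
    ... | no _ with neg v ∈ᴸ? C
    ...   | yes _ = e
    ...   | no n∉ = ⊥-elim (n∉ l∈)

    pLitValue-true : ∀ a C v → pLitValue a C v ≡ true → ind v < np × litValue a C v ≡ true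
    pLitValue-true a C v e with toℕ v <? np
    ... | yes p = p , e
    ... | no _ = ⊥-elim (false≢true e)

    pLitValue-false : ∀ a C v → ind v < np → pLitValue a C v ≡ false → litValue a C v ≡ false
    pLitValue-false a C v lt e with toℕ v <? np
    ... | yes _ = e
    ... | no nlt = ⊥-elim (nlt lt)

    anyPLitTrue : (Fin np → Bool) → List (Lit (Fin n)) → List (Fin n) → Bool
    anyPLitTrue a C [] = false
    anyPLitTrue a C (v ∷ Q) = pLitValue a C v ∨ anyPLitTrue a C Q

    anyPLitTrue-true : ∀ a C Q → anyPLitTrue a C Q ≡ true → Σ (Fin n) λ v → v ∈ Q × pLitValue a C v ≡ true
    anyPLitTrue-true a C (v ∷ Q) e with pLitValue a C v in ev
    ... | true = v , here refl , ev
    ... | false with anyPLitTrue-true a C Q e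
    ...   | w , w∈ , ev' = w , there w∈ , ev'

    anyPLitTrue-false : ∀ a C Q → anyPLitTrue a C Q ≡ false → ∀ {v} → v ∈ Q → pLitValue a C v ≡ false
    anyPLitTrue-false a C (v ∷ Q) e (here refl) = ∨-conicalˡ _ _ e
    anyPLitTrue-false a C (v ∷ Q) e (there w∈) = anyPLitTrue-false a C Q (∨-conicalʳ _ _ e) w∈

    -- Only pivot variables are inspected, which keeps the circuit small; a false p-literal on a
    -- non-pivot variable is harmless since it survives to the end of the refutation (UnresolvedP).
    claim-axiom : ∀ a C s → (∀ l → l ∈ C → compl l ∈ C → ⊥) →
                  ((∀ {l} → l ∈ C → ind (var l) < np → evalLit (pAssign a) l ≡ false) → Subsumed s a (map lit C)) →
                  Claim a (map lit C) (anyPLitTrue a C P) s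
    claim-axiom a C s ntc subsumed = claim ifTrue ifFalse
      where
        ifTrue : anyPLitTrue a C P ≡ true → TrueP a (map lit C)
        ifTrue e with anyPLitTrue-true a C P e
        ... | v , v∈ , ev with pLitValue-true a C v ev
        ...   | lt , ev' with litValue-true a C v ev'
        ...     | l , l∈ , refl , tl = l , ∈-map⁺ lit l∈ , lt , tl

        ifFalse : anyPLitTrue a C P ≡ false → UnresolvedP (map lit C) ⊎ Subsumed s a (map lit C)
        ifFalse e with any? (λ l → (ind (var l) <? np) ×-dec ¬? (var l ∈ᶠ? P)) C
        ... | yes an with find an
        ...   | l , l∈ , (lt , nP) = inj₁ (l , ∈-map⁺ lit l∈ , lt , nP)
        ifFalse e | no nan = inj₂ (subsumed pLitsFalse)
          where
            pLitsFalse : ∀ {l} → l ∈ C → ind (var l) < np → evalLit (pAssign a) l ≡ false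
            pLitsFalse {l} l∈ lt with var l ∈ᶠ? P
            ... | yes v∈ = litValue-false a C l l∈ ntc (pLitValue-false a C (var l) lt (anyPLitTrue-false a C P e v∈))
            ... | no v∉ = ⊥-elim (nan (lose l∈ (lt , v∉)))

    claim-axiomA : ∀ a {C} → C ∈ MA → Claim a (map lit C) (anyPLitTrue a C P) false
    claim-axiomA a {C} C∈ = claim-axiom a C false (nonTaut-compl MA-nonTaut C∈) (λ hf → SA.subsumed-ax C∈ hf onA)
      where
        onA : ∀ {l} → l ∈ C → np ≤ ind (var l) → InA (var l)
        onA l∈ _ with var-∈-mapLit eA A C∈ l∈
        ... | v , e = subst InA (sym e) (eA-< v)

    claim-axiomB : ∀ a {C} → C ∈ MB → Claim a (map lit C) (anyPLitTrue a C P) true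
    claim-axiomB a {C} C∈ = claim-axiom a C true (nonTaut-compl MB-nonTaut C∈) (λ hf → SB.subsumed-ax C∈ hf onB)
      where
        onB : ∀ {l} → l ∈ C → np ≤ ind (var l) → InB (var l)
        onB l∈ le with var-∈-mapLit eB B C∈ l∈
        ... | inj₁ i , e = ⊥-elim (<-irrefl refl (<-≤-trans (toℕ<n i) (subst (np ≤_) (trans (cong toℕ e) (toℕ-eB₁ i)) le)))
        ... | inj₂ j , e = subst InB (sym e) (subst (np + nq ≤_) (sym (toℕ-eB₂ j)) (+-monoʳ-≤ np (m≤m+n nq (toℕ j))))

    open CircuitBuilding np

    grow-litValue : ∀ {k} (gs : Gates np k) C v → toℕ v < np → Grow gs 2 (λ gs' → Computes gs' (λ a → litValue a C v))
    grow-litValue gs C v p with pos v ∈ᴸ? C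
    ... | yes _ = grow-weaken (s≤s z≤n) (grow-cong (λ a → sym (pAssign-< a v p)) (grow-input gs (fromℕ< p)))
    ... | no _ with neg v ∈ᴸ? C
    ...   | yes _ = grow-bind {c = 1} {c' = 1} {Q = λ gs' → Computes gs' (λ a → not (pAssign a v))} (grow-input gs (fromℕ< p))
                      λ gs₁ _ c → grow-cong (λ a → cong not (sym (pAssign-< a v p))) (grow-not gs₁ c)
    ...   | no _ = grow-weaken (s≤s z≤n) (grow-const gs false)

    grow-pLitValue : ∀ {k} (gs : Gates np k) C v → Grow gs 2 (λ gs' → Computes gs' (λ a → pLitValue a C v))
    grow-pLitValue gs C v with toℕ v <? np
    ... | yes p = grow-litValue gs C v p
    ... | no _ = grow-weaken (s≤s z≤n) (grow-const gs false)

    grow-anyPLitTrue : ∀ {k} (gs : Gates np k) C Q → Grow gs (length Q * 3 + 1) (λ gs' → Computes gs' (λ a → anyPLitTrue a C Q))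
    grow-anyPLitTrue gs C [] = grow-const gs false
    grow-anyPLitTrue gs C (v ∷ Q) =
      grow-weaken (≤-reflexive (count (length Q)))
        (grow-bind {c = length Q * 3 + 1} {c' = 3} {Q = Target} (grow-anyPLitTrue gs C Q) λ gs₁ _ cQ →
         grow-bind {c = 2} {c' = 1} {Q = Target} (grow-pLitValue gs₁ C v) λ gs₂ e₂ cv →
         grow-or gs₂ cv (computes-extends e₂ cQ))
      where
        Target : ∀ {k'} → Gates np k' → Set
        Target gs' = Computes gs' (λ a → anyPLitTrue a C (v ∷ Q))

        count : ∀ q → q * 3 + 1 + (2 + 1) ≡ suc q * 3 + 1
        count = solve-∀

    record Tabulated (E : Clause) {k : ℕ} (gs : Gates np k) : Set where
      field
        tGate sGate : ℕ
        tGate<      : tGate < k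
        sGate<      : sGate < k
        claims      : ∀ a → Claim a E (gateAt gs a tGate) (gateAt gs a sGate)

      tValue sValue : (Fin np → Bool) → Bool
      tValue a = gateAt gs a tGate
      sValue a = gateAt gs a sGate

      tComputes : Computes gs (λ a → gateAt gs a tGate)
      tComputes = tGate , tGate< , λ _ → refl

      sComputes : Computes gs (λ a → gateAt gs a sGate)
      sComputes = sGate , sGate< , λ _ → refl

    tabulated-by : ∀ {k} {gs : Gates np k} {E ft fs} → Computes gs ft → Computes gs fs →
                   (∀ a → Claim a E (ft a) (fs a)) → Tabulated E gs
    tabulated-by {E = E} (t , t< , vt) (s , s< , vs) cl = record
      { tGate = t ; sGate = s ; tGate< = t< ; sGate< = s<
      ; claims = λ a → subst₂ (Claim a E) (sym (vt a)) (sym (vs a)) (cl a) }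

    tabulated-extends : ∀ {E k k'} {gs : Gates np k} {gs' : Gates np k'} → Extends gs gs' → Tabulated E gs → Tabulated E gs'
    tabulated-extends e T = tabulated-by (computes-extends e tComputes) (computes-extends e sComputes) claims
      where open Tabulated T

    gatesPerLine : ℕ
    gatesPerLine = length P * 3 + 10

    tabulate-axiomFrom : ∀ {k} (gs : Gates np k) C s → (∀ a → Claim a (map lit C) (anyPLitTrue a C P) s) →
                         Grow gs gatesPerLine (Tabulated (map lit C))
    tabulate-axiomFrom gs C s cl =
      grow-weaken (≤-trans (≤-reflexive (+-assoc (length P * 3) 1 1)) (+-monoʳ-≤ (length P * 3) (s≤s (s≤s z≤n))))
        (grow-bind {c = length P * 3 + 1} {c' = 1} {Q = Tabulated (map lit C)} (grow-anyPLitTrue gs C P) λ gs₁ _ ct →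
           grow-map (λ e₂ cs → tabulated-by (computes-extends e₂ ct) cs cl) (grow-const gs₁ s))

    tabulate-axiom : ∀ {k} (gs : Gates np k) {C} → C ∈ matrix → Grow gs gatesPerLine (Tabulated (map lit C))
    tabulate-axiom gs {C} C∈ with ∈-++⁻ MA C∈
    ... | inj₁ a∈ = tabulate-axiomFrom gs C false (λ a → claim-axiomA a a∈)
    ... | inj₂ b∈ = tabulate-axiomFrom gs C true (λ a → claim-axiomB a b∈)

    tabulate-red : ∀ {k} (gs : Gates np k) {E D} → Tabulated E gs → ForallRed E D → StarsUniversal E →
                   Grow gs gatesPerLine (Tabulated D)
    tabulate-red gs T fr su = grow-weaken z≤n (grow-return (record
      { tGate = tGate ; sGate = sGate ; tGate< = tGate< ; sGate< = sGate<
      ; claims = λ a → claim-red _ fr su (claims a) }))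
      where open Tabulated T

    tabulate-resP : ∀ {k} (gs : Gates np k) {E₁ E₂ R} → Tabulated E₁ gs → Tabulated E₂ gs → (r : Resolution E₁ E₂ R) →
                    NonTaut E₁ → NonTaut E₂ → StarsUniversal E₁ → StarsUniversal E₂ →
                    (xp : ind (Resolution.x r) < np) → Resolution.x r ∈ P → Grow gs 9 (Tabulated R)
    tabulate-resP gs {R = R} T₁ T₂ r nt₁ nt₂ su₁ su₂ xp x∈P =
      grow-bind {c = 1} {c' = 8} {Q = Tabulated R} (grow-input gs (fromℕ< xp)) λ gs₁ e₁ cx →
      grow-bind {c = 4} {c' = 4} {Q = Tabulated R}
        (grow-mux gs₁ cx (computes-extends e₁ T₂.tComputes) (computes-extends e₁ T₁.tComputes)) λ gs₂ e₂ ct →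
      grow-map (λ e₃ cs → tabulated-by (computes-extends e₃ ct) cs claims)
        (grow-mux gs₂ (computes-extends e₂ cx) (computes-extends (extends-trans e₁ e₂) T₂.sComputes)
                                               (computes-extends (extends-trans e₁ e₂) T₁.sComputes))
      where
        module T₁ = Tabulated T₁
        module T₂ = Tabulated T₂
        open ResolutionClaims r nt₁ nt₂ su₁ su₂
        open PivotP xp x∈P

        claims : ∀ a → Claim a R (mux (a (fromℕ< xp)) (T₂.tValue a) (T₁.tValue a)) (mux (a (fromℕ< xp)) (T₂.sValue a) (T₁.sValue a))
        claims a = byPivotValue (pAssign a x) refl
          where
            byPivotValue : ∀ b → pAssign a x ≡ b →
                           Claim a R (mux (a (fromℕ< xp)) (T₂.tValue a) (T₁.tValue a)) (mux (a (fromℕ< xp)) (T₂.sValue a) (T₁.sValue a))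
            byPivotValue true ev rewrite trans (sym (pAssign-< a x xp)) ev =
              subst₂ (Claim a R) (sym (mux-true (T₂.tValue a) (T₁.tValue a))) (sym (mux-true (T₂.sValue a) (T₁.sValue a))) (claim-true _ ev (T₂.claims a))
            byPivotValue false ev rewrite trans (sym (pAssign-< a x xp)) ev = claim-false _ ev (T₁.claims a)

    tabulate-resQR : ∀ {k} (gs : Gates np k) {E₁ E₂ R} (T₁ : Tabulated E₁ gs) (T₂ : Tabulated E₂ gs) (_⊕_ : Bool → Bool → Bool) →
      (∀ {k'} (gs' : Gates np k') {f g} → Computes gs' f → Computes gs' g → Grow gs' 1 (λ gs'' → Computes gs'' (λ a → f a ⊕ g a))) →
      (∀ a → Claim a R (Tabulated.tValue T₁ a ∨ Tabulated.tValue T₂ a) (Tabulated.sValue T₁ a ⊕ Tabulated.sValue T₂ a)) →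
      Grow gs 2 (Tabulated R)
    tabulate-resQR gs {R = R} T₁ T₂ _⊕_ grow-⊕ claims =
      grow-bind {c = 1} {c' = 1} {Q = Tabulated R} (grow-or gs T₁.tComputes T₂.tComputes) λ gs₁ e₁ ct →
      grow-map (λ e₂ cs → tabulated-by (computes-extends e₂ ct) cs claims)
        (grow-⊕ gs₁ (computes-extends e₁ T₁.sComputes) (computes-extends e₁ T₂.sComputes))
      where
        module T₁ = Tabulated T₁
        module T₂ = Tabulated T₂

    ≤gatesPerLine : ∀ c → c ≤ 10 → c ≤ gatesPerLine
    ≤gatesPerLine c le = ≤-trans le (m≤n+m 10 (length P * 3))

    tabulate-res : ∀ {k} (gs : Gates np k) {E₁ E₂ R} → Tabulated E₁ gs → Tabulated E₂ gs → (r : Resolution E₁ E₂ R) →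
                   NonTaut E₁ → NonTaut E₂ → StarsUniversal E₁ → StarsUniversal E₂ → Resolution.x r ∈ P →
                   Grow gs gatesPerLine (Tabulated R)
    tabulate-res gs T₁ T₂ r nt₁ nt₂ su₁ su₂ x∈P with ind (Resolution.x r) <? np | ind (Resolution.x r) <? np + nq
    ... | yes xp | _ = grow-weaken (≤gatesPerLine 9 (n≤1+n 9)) (tabulate-resP gs T₁ T₂ r nt₁ nt₂ su₁ su₂ xp x∈P)
    ... | no nxp | yes xq = grow-weaken (≤gatesPerLine 2 (s≤s (s≤s z≤n))) (tabulate-resQR gs T₁ T₂ _∨_ grow-or
          (λ a → claim-res _ _ _ _ _ (Tabulated.claims T₁ a) (Tabulated.claims T₂ a) (subsumed-q (Tabulated.sValue T₁ a) (Tabulated.sValue T₂ a) xq)))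
      where
        open ResolutionClaims r nt₁ nt₂ su₁ su₂
        open PivotQR (≮⇒≥ nxp)
    ... | no nxp | no nxq = grow-weaken (≤gatesPerLine 2 (s≤s (s≤s z≤n))) (tabulate-resQR gs T₁ T₂ _∧_ grow-and
          (λ a → claim-res _ _ _ _ _ (Tabulated.claims T₁ a) (Tabulated.claims T₂ a) (subsumed-r (Tabulated.sValue T₁ a) (Tabulated.sValue T₂ a) (≮⇒≥ nxq))))
      where
        open ResolutionClaims r nt₁ nt₂ su₁ su₂
        open PivotQR (≮⇒≥ nxp)

    record Table (Γ : List Clause) : Set where
      field
        k          : ℕ
        gates      : Gates np k
        bound      : k ≤ length Γ * gatesPerLine
        wellFormed : ∀ {E} → E ∈ Γ → NonTaut E × StarsUniversal E
        tabulated  : ∀ {E} → E ∈ Γ → Tabulated E gates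

    table-snoc : ∀ {Γ C} (T : Table Γ) → Grow (Table.gates T) gatesPerLine (Tabulated C) →
                 NonTaut C × StarsUniversal C → Table (Γ ++ (C ∷ []))
    table-snoc {Γ} {C} T (mkGrow k' gs' ext gr line) wfC = record
      { k = k' ; gates = gs'
      ; bound = subst (λ z → k' ≤ z * gatesPerLine) (sym (length-snoc Γ C))
                  (≤-trans gr (≤-trans (+-monoˡ-≤ gatesPerLine (Table.bound T))
                                       (≤-reflexive (+-comm (length Γ * gatesPerLine) gatesPerLine))))
      ; wellFormed = wf ; tabulated = tab }
      where
        wf : ∀ {E} → E ∈ Γ ++ (C ∷ []) → NonTaut E × StarsUniversal E
        wf E∈ with ∈-++⁻ Γ E∈
        ... | inj₁ a = Table.wellFormed T a
        ... | inj₂ (here refl) = wfC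

        tab : ∀ {E} → E ∈ Γ ++ (C ∷ []) → Tabulated E gs'
        tab E∈ with ∈-++⁻ Γ E∈
        ... | inj₁ a = tabulated-extends ext (Table.tabulated T a)
        ... | inj₂ (here refl) = line

    tabulate : ∀ {Γ} (d : Derivation Γ) → (∀ {v} → v ∈ pivots d → v ∈ P) → Table Γ
    tabulate [] _ = record { k = 0 ; gates = [] ; bound = z≤n ; wellFormed = λ () ; tabulated = λ () }
    tabulate (d ▷ axiom {C} C∈) ⊆P = table-snoc T (tabulate-axiom (Table.gates T) C∈) (nt , su)
      where
        T = tabulate d ⊆P

        nt : NonTaut (map lit C)
        nt l a b = nonTaut-compl matrix-nonTaut C∈ l (∈-map-lit⁻ a) (∈-map-lit⁻ b)

        su : StarsUniversal (map lit C)
        su a with ∈-map⁻ lit a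
        ... | _ , _ , ()
    tabulate (d ▷ red {E} {D} E∈ fr) ⊆P =
      table-snoc T (tabulate-red (Table.gates T) (Table.tabulated T E∈) fr (proj₂ (Table.wellFormed T E∈))) (nt , su)
      where
        T = tabulate d ⊆P
        open ReductionFacts fr

        nt : NonTaut D
        nt l a b = proj₁ (Table.wellFormed T E∈) l (D⊆E a) (D⊆E b)

        su : StarsUniversal D
        su a = proj₂ (Table.wellFormed T E∈) (D⊆E a)
    tabulate (d ▷ res {E₁} {E₂} E₁∈ E₂∈ r) ⊆P =
      table-snoc T (tabulate-res (Table.gates T) (Table.tabulated T E₁∈) (Table.tabulated T E₂∈) r nt₁ nt₂ su₁ su₂ (⊆P (here refl)))
                 (RF.R-nonTaut , RF.R-starsUniversal)
      where
        T = tabulate d (⊆P ∘ there)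
        nt₁ = proj₁ (Table.wellFormed T E₁∈)
        nt₂ = proj₁ (Table.wellFormed T E₂∈)
        su₁ = proj₂ (Table.wellFormed T E₁∈)
        su₂ = proj₂ (Table.wellFormed T E₂∈)
        module RF = ResolutionFacts r nt₁ nt₂ su₁ su₂

    empty-subsumed : ∀ {a t s} → Claim a [] t s → Subsumed s a []
    empty-subsumed {t = true} (claim h₁ _) with h₁ refl
    ... | _ , () , _
    empty-subsumed {t = false} (claim _ h₂) with h₂ refl
    ... | inj₁ (_ , () , _)
    ... | inj₂ S = S

  module RA = Restricted F MA MA-nonTaut
  module RB = Restricted F MB MB-nonTaut

  ⊆⋆[]-allUniversal : ∀ {L} → L ⊆⋆ [] → ∀ {w} → w ∈ L → IsUniv (pvar w)
  ⊆⋆[]-allUniversal sub w∈ with sub w∈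
  ... | inj₁ ()
  ... | inj₂ (_ , _ , ())

  A-false : ∀ a {L} → SA.SideDer (pAssign a) L → L ⊆⋆ [] → evalQ qs (λ ρ → evalCNF [ a , ρ ] A) ≡ false
  A-false a (d , _) sub =
    trans (sym (evalLevels-MA a)) (RA.falsified (nq + nr) np (+-comm (nq + nr) np) (pAssign a) _ d (⊆⋆[]-allUniversal sub))

  B-false : ∀ a {L} → SB.SideDer (pAssign a) L → L ⊆⋆ [] → evalQ rs (λ ρ → evalCNF [ a , ρ ] B) ≡ false
  B-false a (d , _) sub =
    trans (sym (evalLevels-MB a)) (RB.falsified (nq + nr) np (+-comm (nq + nr) np) (pAssign a) _ d (⊆⋆[]-allUniversal sub))

  interpolant : (π : Refutation) →
    Σ (Circuit np) λ G →
      (csize G ≤ 13 * (size π ^ 2) + 13)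
      × ((a : Fin np → Bool) →
           ((output G a ≡ false → evalQ qs (λ ρ → evalCNF [ a , ρ ] A) ≡ false)
            × (output G a ≡ true → evalQ rs (λ ρ → evalCNF [ a , ρ ] B) ≡ false)))
  interpolant π = G , size-≤ , λ a → sides a (output G a) refl
    where
      open Refutation π
      open WithPivots (pivots deriv)
      open CircuitBuilding np
      T = tabulate deriv (λ v∈ → v∈)
      open Table T using (k; gates; bound)
      open Tabulated (Table.tabulated T empty)

      G : Circuit np
      G = record { k = k ; gates = gates ▷ orG (backRef k sGate sGate<) (backRef k sGate sGate<) }

      output≡s : ∀ a → output G a ≡ sValue a
      output≡s a = trans (cong₂ _∨_ (lookup-backRef gates a sGate sGate<) (lookup-backRef gates a sGate sGate<)) (∨-idem (sValue a))

      size-≤ : csize G ≤ 13 * (size π ^ 2) + 13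
      size-≤ = quadratic-bound (length lines) (length (pivots deriv)) k (pivots-length deriv) bound

      sides : ∀ a b → output G a ≡ b → (b ≡ false → evalQ qs (λ ρ → evalCNF [ a , ρ ] A) ≡ false)
                                       × (b ≡ true → evalQ rs (λ ρ → evalCNF [ a , ρ ] B) ≡ false)
      sides a b o with empty-subsumed (subst (Claim a [] (tValue a)) (trans (sym (output≡s a)) o) (claims a))
      sides a false o | L , dd , sub = (λ _ → A-false a dd sub) , λ ()
      sides a true o | L , dd , sub = (λ ()) , λ _ → B-false a dd sub

theorem3p3 : Σ ℕ λ c → Σ ℕ λ d →
    (np nq nr : ℕ) (qs : Vec Quant nq) (rs : Vec Quant nr)
    (A : CNF (Fin np ⊎ Fin nq)) (B : CNF (Fin np ⊎ Fin nr)) →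
    NonTautCNF A → NonTautCNF B →
    (π : LQU.Refutation (splitQBF np nq nr qs rs A B)) →
    Σ (Circuit np) λ G →
      (csize G ≤ c * (LQU.size (splitQBF np nq nr qs rs A B) π ^ d) + c)
      × ((a : Fin np → Bool) →
           ((output G a ≡ false → evalQ qs (λ ρ → evalCNF [ a , ρ ] A) ≡ false)
            × (output G a ≡ true → evalQ rs (λ ρ → evalCNF [ a , ρ ] B) ≡ false)))
theorem3p3 = 13 , 2 , λ np nq nr qs rs A B A-nonTaut B-nonTaut →
  Interpolation.interpolant np nq nr qs rs A B A-nonTaut B-nonTaut
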